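{- Let $a$ and $d$ be integers with $a\ge 3$, $d>0$ and $\gcd(a,d)=1$. For a nonnegative integer $n$ let $d(n)$ be the number of triples $(x_1,x_2,x_3)$ of nonnegative integers with $a x_1+(a+d)x_2+(a+2d)x_3=n$, and for an integer $p\ge0$ let $s_p(a,a+d,a+2d)=\sum n$, the sum over all nonnegative integers $n$ with $d(n)\le p$. Then for $0\le p\le\lfloor a/2\rfloor$: if $a$ is odd, $$s_p(a,a+d,a+2d)=\frac{(a-1)(a+2d-1)(a^2+2ad-a-d-2)}{24}+\frac{3a^3+9a^2(d-1)+2a(3d^2-9d+1)-6d^2+2d}{6}\,p+\frac{3a^2+a(6d-1)+4d^2-d}{2}\,p^2-\frac{4(a+d)}{3}\,p^3;$$ if $a$ is even, $$s_p(a,a+d,a+2d)=\frac{(a-1)(a+2d-1)(a^2+2ad-a-d-2)+3(a^2+2ad-a-d)}{24}+\frac{3a^3+9a^2(d-1)+a(6d^2-18d+5)-6d^2+5d}{6}\,p+\frac{3a^2+a(6d-1)+4d^2-d}{2}\,p^2-\frac{4(a+d)}{3}\,p^3.$$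
   Context: $s_p$ is the $p$-Sylvester sum: the sum of all nonnegative integers having at most $p$ representations as nonnegative integer combinations of $a,a+d,a+2d$. -}

module Defs where

open import Data.Nat using (ℕ; zero; suc; _+_; _*_; _≤?_; _≟_)
open import Data.List using (List; []; _∷_; upTo; concatMap; filter; length)
open import Data.Nat.ListAction using (sum)
open import Data.Product using (_×_; _,_)
open import Relation.Nullary.Decidable using (⌊_⌋)
open import Data.Bool using (Bool; true; false)

triplesUpTo : ℕ → List (ℕ × ℕ × ℕ)
triplesUpTo n =
  concatMap (λ x → concatMap (λ y → Data.List.map (λ z → (x , y , z)) (upTo (suc n))) (upTo (suc n)))
            (upTo (suc n))

-- d(n) for generators a, a+d, a+2d : number of nonnegative triples with
-- a x1 + (a+d) x2 + (a+2d) x3 = n  (every solution has xi ≤ n when a ≥ 1)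
repCount : ℕ → ℕ → ℕ → ℕ
repCount a d n =
  length (filter (λ t → helper t ≟ n) (triplesUpTo n))
  where
  helper : ℕ × ℕ × ℕ → ℕ
  helper (x , y , z) = a * x + (a + d) * y + (a + 2 * d) * z

sylvesterSumBelow : ℕ → ℕ → ℕ → ℕ → ℕ
sylvesterSumBelow a d p N = sum (filter (λ m → repCount a d m ≤? p) (upTo N))

module Submission where

-- Write a = 2(p + g) + ρ with ρ ∈ {0, 1}. A triple (x, y, z) represents a k + d m, where
-- k = x + y + z is its degree and m = y + 2z its weight, and the triples of one degree and weight
-- form a chain along which x and z grow while y shrinks by 2. Since gcd(a, d) = 1, near a K + d j
-- with j < a only the degrees K, K − d, K − 2d, … with weights j, j + a, j + 2a, … occur, and
-- weight ≤ 2·degree leaves at most two of them. Counting the chains shows that the numbers in the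
-- class of d j mod a with more than p representations are exactly T_j, T_j + a, …, where
-- T_j = a K_j + d j with K_j = ⌊j/2⌋ + (j mod 2) + p for j ≥ 2p and
-- K_j = d + ⌊a/2⌋ + p − 1 + max(j mod 2, ρ) for j < 2p.
-- Selmer's formula 2a s = ∑ T_j² − ∑ c² − a (∑ T_j − ∑ c) (over j, c < a) then gives the sum s,
-- and the T_j split into four arithmetic progressions whose power sums produce the polynomial.

module Representations where

  open import Defs
  open import Data.Nat
  open import Data.Nat.Properties
  open import Data.Nat.DivMod using (m%n<n; m≡m%n+[m/n]*n)
  open import Data.Nat.Tactic.RingSolver using (solve-∀)
  open import Data.List using (List; []; _∷_; _++_; map; filter; length; upTo; concatMap)
  open import Data.List.Properties using (length-++; length-map)
  open import Data.List.Membership.Propositional using (_∈_; _∉_)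
  open import Data.List.Membership.Propositional.Properties
    using (∈-∃++; ∈-++⁺ˡ; ∈-++⁺ʳ; ∈-++⁻; ∈-map⁺; ∈-map⁻; ∈-filter⁺; ∈-filter⁻; ∈-upTo⁺; ∈-concatMap⁺; ∈-concatMap⁻)
  open import Data.List.Relation.Binary.Subset.Propositional using (_⊆_)
  open import Data.List.Relation.Unary.Unique.Propositional using (Unique)
  import Data.List.Relation.Unary.Unique.Propositional.Properties as Unique
  import Data.List.Relation.Unary.All as All
  import Data.List.Relation.Unary.All.Properties as All
  import Data.List.Relation.Unary.AllPairs as AllPairs
  import Data.List.Relation.Unary.AllPairs.Properties as AllPairs
  open import Data.List.Relation.Unary.Any as Any using (here; there)
  open import Data.Product using (_×_; _,_; ∃₂; proj₁; proj₂)
  open import Data.Sum using (_⊎_; inj₁; inj₂)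
  open import Data.Empty using (⊥-elim)
  open import Relation.Binary.PropositionalEquality
  open import Relation.Nullary using (yes; no)
  open import Relation.Binary.Definitions using (DecidableEquality)
  open import Function.Base using (_∘_)

  ⊆-without : ∀ {A : Set} {x : A} {xs} ys₁ {ys₂} → x ∉ xs → xs ⊆ ys₁ ++ x ∷ ys₂ → xs ⊆ ys₁ ++ ys₂
  ⊆-without ys₁ x∉xs xs⊆ v∈xs with ∈-++⁻ ys₁ (xs⊆ v∈xs)
  ... | inj₁ v∈ys₁ = ∈-++⁺ˡ v∈ys₁
  ... | inj₂ (here refl) = ⊥-elim (x∉xs v∈xs)
  ... | inj₂ (there v∈ys₂) = ∈-++⁺ʳ ys₁ v∈ys₂

  length-without : ∀ {A : Set} (ys₁ : List A) {x ys₂} → length (ys₁ ++ x ∷ ys₂) ≡ suc (length (ys₁ ++ ys₂))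
  length-without ys₁ {x} {ys₂} = begin
    length (ys₁ ++ x ∷ ys₂)         ≡⟨ length-++ ys₁ ⟩
    length ys₁ + suc (length ys₂)   ≡⟨ +-suc (length ys₁) (length ys₂) ⟩
    suc (length ys₁ + length ys₂)   ≡⟨ cong suc (length-++ ys₁) ⟨
    suc (length (ys₁ ++ ys₂))       ∎
    where open ≡-Reasoning

  length-≤-of-⊆ : ∀ {A : Set} {xs ys : List A} → Unique xs → xs ⊆ ys → length xs ≤ length ys
  length-≤-of-⊆ {xs = []} _ _ = z≤n
  length-≤-of-⊆ {xs = x ∷ xs} (x∉xs AllPairs.∷ unique-xs) xs⊆ys with ∈-∃++ (xs⊆ys (here refl))
  ... | ys₁ , ys₂ , refl =
    ≤-trans (s≤s (length-≤-of-⊆ unique-xs (⊆-without ys₁ (λ x∈xs → All.lookup x∉xs x∈xs refl) (xs⊆ys ∘ there))))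
            (≤-reflexive (sym (length-without ys₁)))

  ⊆-length⇒⊇ : ∀ {A : Set} → DecidableEquality A → {xs ys : List A} → Unique xs → xs ⊆ ys → length ys ≤ length xs → ys ⊆ xs
  ⊆-length⇒⊇ _≟_ {xs} unique-xs xs⊆ys |ys|≤|xs| {y} y∈ys with Any.any? (y ≟_) xs
  ... | yes y∈xs = y∈xs
  ... | no y∉xs with ∈-∃++ y∈ys
  ...   | ys₁ , ys₂ , refl = ⊥-elim (<⇒≱ (≤-trans (s≤s (length-≤-of-⊆ unique-xs (⊆-without ys₁ y∉xs xs⊆ys)))
                                                  (≤-reflexive (sym (length-without ys₁)))) |ys|≤|xs|)

  Unique-concatMap : ∀ {A B : Set} {f : A → List B} {xs : List A} →
    (∀ x → Unique (f x)) → Unique xs → (∀ {x x′ b} → b ∈ f x → b ∈ f x′ → x ≡ x′) →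
    Unique (concatMap f xs)
  Unique-concatMap {f = f} {xs} unique-f unique-xs separated =
    Unique.concat⁺ (All.map⁺ (All.tabulate λ {x} _ → unique-f x))
      (AllPairs.map⁺ (AllPairs.map (λ x≢x′ {_} (b∈fx , b∈fx′) → x≢x′ (separated b∈fx b∈fx′)) unique-xs))

  Triple : Set
  Triple = ℕ × ℕ × ℕ

  value : ℕ → ℕ → Triple → ℕ
  value a d (x , y , z) = a * x + (a + d) * y + (a + 2 * d) * z

  value-by-degree-weight : ∀ a d x y z → a * x + (a + d) * y + (a + 2 * d) * z ≡ a * (x + y + z) + d * (y + 2 * z)
  value-by-degree-weight = solve-∀

  triplesUpTo-unique : ∀ n → Unique (triplesUpTo n)
  triplesUpTo-unique n =
    Unique-concatMap (λ x → Unique-concatMap (λ y → Unique.map⁺ (λ { refl → refl }) (Unique.upTo⁺ (suc n)))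
                                              (Unique.upTo⁺ (suc n)) second-separated)
                     (Unique.upTo⁺ (suc n)) first-separated
    where
    L : List ℕ
    L = upTo (suc n)
    second-separated : ∀ {x y y′ : ℕ} {t : Triple} → t ∈ map (λ z → x , y , z) L → t ∈ map (λ z → x , y′ , z) L → y ≡ y′
    second-separated t∈ t∈′ with ∈-map⁻ _ t∈ | ∈-map⁻ _ t∈′
    ... | _ , _ , refl | _ , _ , refl = refl
    first-of : ∀ {x : ℕ} {t : Triple} → t ∈ concatMap (λ y → map (λ z → x , y , z) L) L → proj₁ t ≡ x
    first-of {x} t∈ with Any.satisfied (∈-concatMap⁻ (λ y → map (λ z → x , y , z) L) {xs = L} t∈)
    ... | _ , t∈′ with ∈-map⁻ _ t∈′
    ... | _ , _ , refl = refl
    first-separated : ∀ {x x′ : ℕ} {t : Triple} → t ∈ concatMap (λ y → map (λ z → x , y , z) L) L →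
                      t ∈ concatMap (λ y → map (λ z → x′ , y , z) L) L → x ≡ x′
    first-separated t∈ t∈′ = trans (sym (first-of t∈)) (first-of t∈′)

  ∈-triplesUpTo : ∀ {n x y z} → x ≤ n → y ≤ n → z ≤ n → (x , y , z) ∈ triplesUpTo n
  ∈-triplesUpTo {n} {x} {y} {z} x-bound y-bound z-bound =
    ∈-concatMap⁺ (λ x → concatMap (λ y → map (λ z → x , y , z) L) L)
      (Any.map (λ { refl → ∈-concatMap⁺ (λ y → map (λ z → x , y , z) L)
                             (Any.map (λ { refl → ∈-map⁺ (λ z → x , y , z) (∈-upTo⁺ (s≤s z-bound)) })
                                      (∈-upTo⁺ (s≤s y-bound))) })
               (∈-upTo⁺ (s≤s x-bound)))
    where
    L : List ℕ
    L = upTo (suc n)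

  module _ {a d : ℕ} where

    solutions : ℕ → List Triple
    solutions n = filter (λ t → value a d t ≟ n) (triplesUpTo n)

    degree≤value : .{{_ : NonZero a}} → ∀ x y z → x + y + z ≤ value a d (x , y , z)
    degree≤value x y z = begin
      x + y + z                             ≤⟨ m≤n*m (x + y + z) a ⟩
      a * (x + y + z)                       ≤⟨ m≤m+n _ _ ⟩
      a * (x + y + z) + d * (y + 2 * z)     ≡⟨ value-by-degree-weight a d x y z ⟨
      value a d (x , y , z)                 ∎
      where open ≤-Reasoning

    ∈-solutions : .{{_ : NonZero a}} → ∀ {n x y z} → value a d (x , y , z) ≡ n → (x , y , z) ∈ solutions n
    ∈-solutions {n} {x} {y} {z} refl = ∈-filter⁺ (λ t → value a d t ≟ n)
      (∈-triplesUpTo (≤-trans (≤-trans (m≤m+n x y) (m≤m+n _ z)) bound)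
                     (≤-trans (≤-trans (m≤n+m y x) (m≤m+n _ z)) bound)
                     (≤-trans (m≤n+m z (x + y)) bound))
      refl
      where
      bound : x + y + z ≤ value a d (x , y , z)
      bound = degree≤value x y z

    repCount-≥ : .{{_ : NonZero a}} → ∀ {n} (L : List Triple) → Unique L → (∀ {t} → t ∈ L → value a d t ≡ n) →
                 length L ≤ repCount a d n
    repCount-≥ L unique-L solves = length-≤-of-⊆ unique-L (λ t∈L → ∈-solutions (solves t∈L))

    repCount-≤ : ∀ {n} (L : List Triple) (i : ℕ) →
                 (∀ {x y z} → value a d (x , y , z) ≡ n → (x + i , y , z) ∈ L) → repCount a d n ≤ length L
    repCount-≤ {n} L i shift-∈ = begin
      length (solutions n)            ≡⟨ length-map shift (solutions n) ⟨
      length (map shift (solutions n)) ≤⟨ length-≤-of-⊆ unique-shifted shifted⊆L ⟩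
      length L                        ∎
      where
      open ≤-Reasoning
      shift : Triple → Triple
      shift (x , y , z) = x + i , y , z
      shift-injective : ∀ {s t} → shift s ≡ shift t → s ≡ t
      shift-injective {_ , _} {_ , _} eq = cong₂ _,_ (+-cancelʳ-≡ i _ _ (cong proj₁ eq)) (cong proj₂ eq)
      unique-shifted : Unique (map shift (solutions n))
      unique-shifted = Unique.map⁺ shift-injective (Unique.filter⁺ (λ t → value a d t ≟ n) (triplesUpTo-unique n))
      shifted⊆L : map shift (solutions n) ⊆ L
      shifted⊆L t∈ with ∈-map⁻ shift t∈
      ... | (x , y , z) , s∈ , refl = shift-∈ (proj₂ (∈-filter⁻ (λ t → value a d t ≟ n) s∈))

  parity-unique : ∀ {r r′ m n} → r ≤ 1 → r′ ≤ 1 → r + 2 * m ≡ r′ + 2 * n → r ≡ r′ × m ≡ n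
  parity-unique {0} {0} {m} {n} _ _ eq = refl , *-cancelˡ-≡ m n 2 eq
  parity-unique {1} {1} {m} {n} _ _ eq = refl , *-cancelˡ-≡ m n 2 (suc-injective eq)
  parity-unique {0} {1} {m} {n} _ _ eq = ⊥-elim (even≢odd m n eq)
  parity-unique {1} {0} {m} {n} _ _ eq = ⊥-elim (even≢odd n m (sym eq))
  parity-unique {suc (suc _)} (s≤s ()) _ _
  parity-unique {_} {suc (suc _)} _ (s≤s ()) _

  parity-decomposition : ∀ y → y % 2 ≤ 1 × y ≡ y % 2 + 2 * (y / 2)
  parity-decomposition y = ≤-pred (m%n<n y 2) , trans (m≡m%n+[m/n]*n y 2) (cong (y % 2 +_) (*-comm (y / 2) 2))

  halves : ∀ {a m ρ} → ρ ≤ 1 → a ≡ 2 * m + ρ → a % 2 ≡ ρ × a / 2 ≡ m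
  halves {a} {m} {ρ} ρ≤1 a≡ = parity-unique (proj₁ (parity-decomposition a)) ρ≤1
    (trans (sym (proj₂ (parity-decomposition a))) (trans a≡ (+-comm (2 * m) ρ)))

  -- chain X R E s lists the s triples (X + u, R + 2v, E + u) with u + v = s − 1, which all have
  -- degree X + R + E + 2(s − 1) and weight R + 2E + 2(s − 1).
  chain : ℕ → ℕ → ℕ → ℕ → List Triple
  chain X R E zero = []
  chain X R E (suc s) = (X , R + 2 * s , E) ∷ chain (suc X) R (suc E) s

  module _ (R : ℕ) where

    length-chain : ∀ X E s → length (chain X R E s) ≡ s
    length-chain X E zero = refl
    length-chain X E (suc s) = cong suc (length-chain (suc X) (suc E) s)

    ∈-chain⁻ : ∀ {X E s t} → t ∈ chain X R E s → ∃₂ λ u v → suc (u + v) ≡ s × t ≡ (X + u , R + 2 * v , E + u)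
    ∈-chain⁻ {X} {E} {suc s} (here refl) = 0 , s , refl , cong₂ _,_ (sym (+-identityʳ X)) (cong (R + 2 * s ,_) (sym (+-identityʳ E)))
    ∈-chain⁻ {X} {E} {suc s} (there t∈) with ∈-chain⁻ t∈
    ... | u , v , refl , refl = suc u , v , refl , cong₂ _,_ (sym (+-suc X u)) (cong (R + 2 * v ,_) (sym (+-suc E u)))

    ∈-chain⁺ : ∀ X E u v → (X + u , R + 2 * v , E + u) ∈ chain X R E (suc (u + v))
    ∈-chain⁺ X E zero v = here (cong₂ _,_ (+-identityʳ X) (cong (R + 2 * v ,_) (+-identityʳ E)))
    ∈-chain⁺ X E (suc u) v = subst (_∈ chain X R E (suc (suc u + v)))
      (cong₂ _,_ (sym (+-suc X u)) (cong (R + 2 * v ,_) (sym (+-suc E u))))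
      (there (∈-chain⁺ (suc X) (suc E) u v))

    third-∈-chain : ∀ {X E s x y z} → (x , y , z) ∈ chain X R E s → E ≤ z × z < E + s
    third-∈-chain {E = E} t∈ with ∈-chain⁻ t∈
    ... | u , v , refl , refl = m≤m+n E u , +-monoʳ-< E (s≤s (m≤m+n u v))

    chain-unique : ∀ X E s → Unique (chain X R E s)
    chain-unique X E zero = AllPairs.[]
    chain-unique X E (suc s) = All.tabulate head-fresh AllPairs.∷ chain-unique (suc X) (suc E) s
      where
      head-fresh : ∀ {t} → t ∈ chain (suc X) R (suc E) s → (X , R + 2 * s , E) ≢ t
      head-fresh t∈ refl = <-irrefl refl (proj₁ (third-∈-chain t∈))

    value-∈-chain : ∀ a d {X E S t} → t ∈ chain X R E (suc S) →
                    value a d t ≡ a * (X + R + E + 2 * S) + d * (R + 2 * E + 2 * S)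
    value-∈-chain a d {X} {E} t∈ with ∈-chain⁻ t∈
    ... | u , v , refl , refl = along a d X R E u v
      where
      along : ∀ a d X R E u v → a * (X + u) + (a + d) * (R + 2 * v) + (a + 2 * d) * (E + u)
                              ≡ a * (X + R + E + 2 * (u + v)) + d * (R + 2 * E + 2 * (u + v))
      along = solve-∀

    -- Under the side conditions the chain exhausts its fibre: its last member has y = R ≤ 1, and
    -- its first member has x = 0 or z = 0.
    ∈-chain-of-fibre : ∀ {X E s x y z} → R ≤ 1 → X ≡ 0 ⊎ E ≡ 0 →
      y + 2 * z + 2 ≡ R + 2 * (E + s) → x + y + z + 2 ≡ X + R + E + 2 * s → (x , y , z) ∈ chain X R E s
    ∈-chain-of-fibre {X} {E} {s} {x} {y} {z} R≤1 ends weight-eq degree-eq = from-end ends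
      where
      v : ℕ
      v = y / 2
      r+2v≡y : y % 2 + 2 * v ≡ y
      r+2v≡y = sym (proj₂ (parity-decomposition y))
      y-halves : y % 2 ≡ R × v + z + 1 ≡ E + s
      y-halves = parity-unique (proj₁ (parity-decomposition y)) R≤1
        (trans (regroup (y % 2) v z) (trans (cong (λ w → w + 2 * z + 2) r+2v≡y) weight-eq))
        where
        regroup : ∀ r v z → r + 2 * (v + z + 1) ≡ r + 2 * v + 2 * z + 2
        regroup = solve-∀
      y≡R+2v : y ≡ R + 2 * v
      y≡R+2v = trans (sym r+2v≡y) (cong (_+ 2 * v) (proj₁ y-halves))
      x+E≡X+z : x + E ≡ X + z
      x+E≡X+z = +-cancelʳ-≡ K (x + E) (X + z)
        (trans (regroupˡ x y z R E s) (trans (cong₂ _+_ degree-eq (sym weight-eq)) (regroupʳ X R E s y z)))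
        where
        K : ℕ
        K = y + z + 2 + R + E + 2 * s
        regroupˡ : ∀ x y z R E s → x + E + (y + z + 2 + R + E + 2 * s) ≡ x + y + z + 2 + (R + 2 * (E + s))
        regroupˡ = solve-∀
        regroupʳ : ∀ X R E s y z → X + R + E + 2 * s + (y + 2 * z + 2) ≡ X + z + (y + z + 2 + R + E + 2 * s)
        regroupʳ = solve-∀
      from-end : X ≡ 0 ⊎ E ≡ 0 → (x , y , z) ∈ chain X R E s
      from-end (inj₁ refl) =
        subst₂ (λ t s → t ∈ chain 0 R E s) (cong₂ _,_ refl (cong₂ _,_ (sym y≡R+2v) (sym z≡E+x))) s≡ (∈-chain⁺ 0 E x v)
        where
        z≡E+x : z ≡ E + x
        z≡E+x = trans (sym x+E≡X+z) (+-comm x E)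
        s≡ : suc (x + v) ≡ s
        s≡ = +-cancelˡ-≡ E _ _ (trans (shuffle E x v) (trans (cong (λ w → v + w + 1) (sym z≡E+x)) (proj₂ y-halves)))
          where
          shuffle : ∀ E x v → E + suc (x + v) ≡ v + (E + x) + 1
          shuffle = solve-∀
      from-end (inj₂ refl) =
        subst₂ (λ t s → t ∈ chain X R 0 s) (cong₂ _,_ (sym x≡X+z) (cong₂ _,_ (sym y≡R+2v) refl)) s≡ (∈-chain⁺ X 0 z v)
        where
        x≡X+z : x ≡ X + z
        x≡X+z = trans (sym (+-identityʳ x)) x+E≡X+z
        s≡ : suc (z + v) ≡ s
        s≡ = trans (shuffle z v) (proj₂ y-halves)
          where
          shuffle : ∀ z v → suc (z + v) ≡ v + z + 1
          shuffle = solve-∀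

module Residues where

  open import Data.Nat
  open import Data.Nat.Properties
  open import Data.Nat.Tactic.RingSolver using (solve-∀)
  open import Data.Nat.DivMod using (_%_; _/_; m≡m%n+[m/n]*n; m*n/n≡m; /-monoˡ-≤)
  open import Data.Nat.Divisibility using (_∣_; divides; ∣m+n∣m⇒∣n; m∣m*n)
  open import Data.Nat.Coprimality using (Coprime; coprime-divisor)
  open import Data.Product using (_×_; _,_; ∃)
  open import Data.Sum using (inj₁; inj₂)
  open import Data.Empty using (⊥-elim)
  open import Relation.Binary.PropositionalEquality

  module _ {a d : ℕ} .{{_ : NonZero a}} (coprime : Coprime a d) where

    coprime-step : ∀ {k δ K} → a * k + d * δ ≡ a * K → ∃ λ t → δ ≡ a * t × k + d * t ≡ K
    coprime-step {k} {δ} {K} eq with coprime-divisor coprime (∣m+n∣m⇒∣n a∣ak+dδ (m∣m*n k))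
      where
      a∣ak+dδ : a ∣ a * k + d * δ
      a∣ak+dδ = divides K (trans eq (*-comm a K))
    ... | divides t refl = t , *-comm t a , *-cancelˡ-≡ (k + d * t) K a (trans (rearrange a d k t) eq)
      where
      rearrange : ∀ a d k t → a * (k + d * t) ≡ a * k + d * (t * a)
      rearrange = solve-∀

    line-points : ∀ {k m K j} → j < a → a * k + d * m ≡ a * K + d * j → ∃ λ t → m ≡ j + a * t × k + d * t ≡ K
    line-points {k} {m} {K} {j} j<a eq with ≤-total j m
    ... | inj₁ j≤m with m≤n⇒∃[o]m+o≡n j≤m
    ...   | δ , refl with coprime-step (+-cancelʳ-≡ (d * j) _ _ (trans (regroup a d k j δ) eq))
      where
      regroup : ∀ a d k j δ → a * k + d * δ + d * j ≡ a * k + d * (j + δ)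
      regroup = solve-∀
    ...   | t , refl , k+dt≡K = t , refl , k+dt≡K
    line-points {k} {m} {K} {j} j<a eq | inj₂ m≤j with m≤n⇒∃[o]m+o≡n m≤j
    ...   | δ , refl with coprime-step (+-cancelʳ-≡ (d * m) _ _ (trans (regroup a d K m δ) (sym eq)))
      where
      regroup : ∀ a d K m δ → a * K + d * δ + d * m ≡ a * K + d * (m + δ)
      regroup = solve-∀
    ...   | zero , refl , K+d0≡k = 0 , no-step a m , trans (cong (_+ d * 0) (sym K+d0≡k)) (sym (no-step d K))
      where
      no-step : ∀ a m → m ≡ m + a * 0 + a * 0
      no-step = solve-∀
    ...   | suc t , refl , _ = ⊥-elim (<⇒≱ j<a (≤-trans (m≤m*n a (suc t)) (m≤n+m (a * suc t) m)))

    *-%-injective : ∀ {i j} → i < a → j < a → (d * i) % a ≡ (d * j) % a → i ≡ j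
    *-%-injective {i} {j} i<a j<a same-residue with line-points {k = d * i / a} {m = j} {K = d * j / a} i<a crossed
      where
      crossed : a * (d * i / a) + d * j ≡ a * (d * j / a) + d * i
      crossed = begin
        a * (d * i / a) + d * j                           ≡⟨ cong (a * (d * i / a) +_) (m≡m%n+[m/n]*n (d * j) a) ⟩
        a * (d * i / a) + ((d * j) % a + d * j / a * a)   ≡⟨ cong (λ r → a * (d * i / a) + (r + d * j / a * a)) same-residue ⟨
        a * (d * i / a) + ((d * i) % a + d * j / a * a)   ≡⟨ swap a ((d * i) % a) (d * i / a) (d * j / a) ⟩
        a * (d * j / a) + ((d * i) % a + d * i / a * a)   ≡⟨ cong (a * (d * j / a) +_) (m≡m%n+[m/n]*n (d * i) a) ⟨
        a * (d * j / a) + d * i                           ∎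
        where
        open ≡-Reasoning
        swap : ∀ a r q q′ → a * q + (r + q′ * a) ≡ a * q′ + (r + q * a)
        swap = solve-∀
    ... | zero , j≡i+a0 , _ = sym (trans j≡i+a0 (trans (cong (i +_) (*-zeroʳ a)) (+-identityʳ i)))
    ... | suc t , refl , _ = ⊥-elim (<⇒≱ j<a (≤-trans (m≤m*n a (suc t)) (m≤n+m (a * suc t) i)))

  m≡n*[m/n]+m%n : ∀ m n .{{_ : NonZero n}} → m ≡ n * (m / n) + m % n
  m≡n*[m/n]+m%n m n = trans (m≡m%n+[m/n]*n m n) (trans (+-comm (m % n) _) (cong (_+ m % n) (*-comm (m / n) n)))

  m≤n*o⇒m/n≤o : ∀ {m n o} .{{_ : NonZero n}} → m ≤ n * o → m / n ≤ o
  m≤n*o⇒m/n≤o {m} {n} {o} m≤no = subst (m / n ≤_) (trans (cong (_/ n) (*-comm n o)) (m*n/n≡m o n)) (/-monoˡ-≤ n m≤no)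

  n*o≤m⇒o≤m/n : ∀ {m n o} .{{_ : NonZero n}} → n * o ≤ m → o ≤ m / n
  n*o≤m⇒o≤m/n {m} {n} {o} no≤m = subst (_≤ m / n) (trans (cong (_/ n) (*-comm n o)) (m*n/n≡m o n)) (/-monoˡ-≤ n no≤m)

module Thresholds where

  open import Defs
  open Representations
  open Residues
  open import Data.Nat
  open import Data.Nat.Properties
  open import Data.Nat.Tactic.RingSolver using (solve-∀)
  open import Data.Nat.Coprimality using (Coprime)
  open import Data.List using (List; _++_; length)
  open import Data.List.Properties using (length-++)
  open import Data.List.Membership.Propositional using (_∈_)
  open import Data.List.Membership.Propositional.Properties using (∈-++⁺ˡ; ∈-++⁺ʳ; ∈-++⁻)
  import Data.List.Relation.Unary.Unique.Propositional.Properties as Unique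
  open import Data.Product using (_×_; _,_; ∃; proj₁; proj₂)
  open import Data.Sum using (inj₁; inj₂)
  open import Data.Empty using (⊥-elim)
  open import Relation.Binary.PropositionalEquality
  open import Relation.Nullary using (¬_; Dec; yes; no)

  record IsThreshold (a d p T : ℕ) : Set where
    field
      above : ∀ i → p < repCount a d (T + a * i)
      below : ∀ {V} i → V + a * suc i ≡ T → repCount a d V ≤ p

  line-point-bound : ∀ {a d j K t x y z} → y + 2 * z ≡ j + a * t → x + y + z + 1 + d * t ≡ K →
                     j + a * t + 2 * (d * t) + 2 ≤ 2 * K
  line-point-bound {a} {d} {j} {K} {t} {x} {y} {z} weight-eq degree-eq = begin
    j + a * t + 2 * (d * t) + 2                           ≡⟨ cong (λ m → m + 2 * (d * t) + 2) weight-eq ⟨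
    y + 2 * z + 2 * (d * t) + 2                           ≤⟨ m≤n+m _ (2 * x + y) ⟩
    2 * x + y + (y + 2 * z + 2 * (d * t) + 2)             ≡⟨ regroup x y z (d * t) ⟩
    2 * (x + y + z + 1 + d * t)                           ≡⟨ cong (2 *_) degree-eq ⟩
    2 * K                                                 ∎
    where
    open ≤-Reasoning
    regroup : ∀ x y z u → 2 * x + y + (y + 2 * z + 2 * u + 2) ≡ 2 * (x + y + z + 1 + u)
    regroup = solve-∀

  line-point-below : ∀ {a d} .{{_ : NonZero a}} → Coprime a d → ∀ {K j V i x y z} → j < a →
    V + a * suc i ≡ a * K + d * j → value a d (x , y , z) ≡ V →
    ∃ λ t → y + 2 * z ≡ j + a * t × x + i + y + z + 1 + d * t ≡ K
  line-point-below {a} {d} coprime {K} {j} {V} {i} {x} {y} {z} j<a V+a[1+i]≡T refl =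
    line-points coprime j<a (trans (regroup a d x y z i) V+a[1+i]≡T)
    where
    regroup : ∀ a d x y z i → a * (x + i + y + z + 1) + d * (y + 2 * z)
                              ≡ a * x + (a + d) * y + (a + 2 * d) * z + a * suc i
    regroup = solve-∀

  -- From 2p on, the chain of degree K and weight j alone has p + 1 members.
  module BigCase {a d : ℕ} .{{_ : NonZero a}} (coprime : Coprime a d) {p e r : ℕ}
    (r≤1 : r ≤ 1) (j<a : 2 * p + 2 * e + r < a) where

    j K : ℕ
    j = 2 * p + 2 * e + r
    K = 2 * p + e + r

    above : ∀ i → p < repCount a d (a * K + d * j + a * i)
    above i = subst (_≤ repCount a d (a * K + d * j + a * i)) (length-chain r i e (suc p))
      (repCount-≥ {a} {d} (chain i r e (suc p)) (chain-unique r i e (suc p))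
                  (λ t∈ → trans (value-∈-chain r a d t∈) (regroup a d i e r p)))
      where
      regroup : ∀ a d i e r p → a * (i + r + e + 2 * p) + d * (r + 2 * e + 2 * p)
                                ≡ a * (2 * p + e + r) + d * (2 * p + 2 * e + r) + a * i
      regroup = solve-∀

    far-line-point : ∀ t → 2 * K < j + a * suc t + 2 * (d * suc t) + 2
    far-line-point t = begin-strict
      2 * K                                 <⟨ n<1+n (2 * K) ⟩
      suc (2 * K)                           ≡⟨ regroup p e r ⟩
      j + suc (2 * p + r)                   ≤⟨ +-monoʳ-≤ j (≤-<-trans (+-monoʳ-≤ (2 * p) (m≤n+m r (2 * e))) j<a′) ⟩
      j + a                                 ≤⟨ +-monoʳ-≤ j (m≤m*n a (suc t)) ⟩
      j + a * suc t                         ≤⟨ m≤m+n _ _ ⟩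
      j + a * suc t + 2 * (d * suc t)       ≤⟨ m≤m+n _ 2 ⟩
      j + a * suc t + 2 * (d * suc t) + 2   ∎
      where
      open ≤-Reasoning
      j<a′ : 2 * p + (2 * e + r) < a
      j<a′ = subst (_< a) (+-assoc (2 * p) (2 * e) r) j<a
      regroup : ∀ p e r → suc (2 * (2 * p + e + r)) ≡ 2 * p + 2 * e + r + suc (2 * p + r)
      regroup = solve-∀

    below : ∀ {V} i → V + a * suc i ≡ a * K + d * j → repCount a d V ≤ p
    below {V} i V+a[1+i]≡T = subst (repCount a d V ≤_) (length-chain r 0 (suc e) p)
      (repCount-≤ {a} {d} (chain 0 r (suc e) p) i on-chain)
      where
      on-chain : ∀ {x y z} → value a d (x , y , z) ≡ V → (x + i , y , z) ∈ chain 0 r (suc e) p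
      on-chain {x} {y} {z} solves with line-point-below coprime {K} {j} j<a V+a[1+i]≡T solves
      ... | zero , weight-eq , degree-eq = ∈-chain-of-fibre r r≤1 (inj₁ refl)
            (trans (cong (_+ 2) weight-eq) (weight-regroup a p e r))
            (trans (degree-regroup (x + i) y z d) (trans (cong suc degree-eq) (K-regroup p e r)))
        where
        weight-regroup : ∀ a p e r → 2 * p + 2 * e + r + a * 0 + 2 ≡ r + 2 * (suc e + p)
        weight-regroup = solve-∀
        degree-regroup : ∀ x y z d → x + y + z + 2 ≡ suc (x + y + z + 1 + d * 0)
        degree-regroup = solve-∀
        K-regroup : ∀ p e r → suc (2 * p + e + r) ≡ 0 + r + suc e + 2 * p
        K-regroup = solve-∀
      ... | suc t , weight-eq , degree-eq =
        ⊥-elim (<⇒≱ (far-line-point t) (line-point-bound {a} {d} {j} {K} {suc t} {x + i} weight-eq degree-eq))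

    isThreshold : IsThreshold a d p (a * K + d * j)
    isThreshold = record { above = above ; below = below }

  half-adder : ∀ {r ρ} → r ≤ 1 → ρ ≤ 1 →
    ∃ λ r₁ → ∃ λ q → ∃ λ c → r₁ ≤ 1 × r + ρ ≡ r₁ + 2 * q × r ⊔ ρ ≡ r + c × r + c ≡ r₁ + q
  half-adder {0} {0} _ _ = 0 , 0 , 0 , z≤n , refl , refl , refl
  half-adder {1} {0} _ _ = 1 , 0 , 0 , ≤-refl , refl , refl , refl
  half-adder {0} {1} _ _ = 1 , 0 , 1 , ≤-refl , refl , refl , refl
  half-adder {1} {1} _ _ = 0 , 1 , 0 , z≤n , refl , refl , refl
  half-adder {suc (suc _)} (s≤s ()) _
  half-adder {_} {suc (suc _)} _ (s≤s ())

  -- Below 2p two chains are needed, of weights j and j + a; together they have p + 1 members.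
  module SmallCase {a d : ℕ} .{{_ : NonZero a}} (coprime : Coprime a d) {g h w ρ r r₁ q c : ℕ}
    (a≡ : a ≡ 2 * (suc (h + w) + g) + ρ) (r≤1 : r ≤ 1) (ρ≤1 : ρ ≤ 1) (r₁≤1 : r₁ ≤ 1)
    (sum-bit : r + ρ ≡ r₁ + 2 * q) (max-bit : r ⊔ ρ ≡ r + c) (carry : r + c ≡ r₁ + q) where

    p j K : ℕ
    p = suc (h + w)
    j = 2 * h + r
    K = d + (p + g) + (h + w) + (r ⊔ ρ)

    K≡ : K ≡ d + (p + g) + (h + w) + (r + c)
    K≡ = cong (d + (p + g) + (h + w) +_) max-bit

    j+a≡ : j + a ≡ r₁ + 2 * q + 2 * (2 * h + w + g + 1)
    j+a≡ = begin
      2 * h + r + a                         ≡⟨ cong (2 * h + r +_) a≡ ⟩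
      2 * h + r + (2 * (p + g) + ρ)         ≡⟨ regroup h w g r ρ ⟩
      r + ρ + 2 * (2 * h + w + g + 1)       ≡⟨ cong (_+ 2 * (2 * h + w + g + 1)) sum-bit ⟩
      r₁ + 2 * q + 2 * (2 * h + w + g + 1)  ∎
      where
      open ≡-Reasoning
      regroup : ∀ h w g r ρ → 2 * h + r + (2 * (suc (h + w) + g) + ρ) ≡ r + ρ + 2 * (2 * h + w + g + 1)
      regroup = solve-∀

    above : ∀ i → p < repCount a d (a * K + d * j + a * i)
    above i = subst (_≤ repCount a d (a * K + d * j + a * i)) lengths
      (repCount-≥ {a} {d} (chain₀ ++ chain₁)
        (Unique.++⁺ (chain-unique r X₀ 0 (suc h)) (chain-unique r₁ i e₁ (suc w)) disjoint) solves)
      where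
      X₀ e₁ : ℕ
      X₀ = d + 2 * w + g + 1 + c + i
      e₁ = 2 * h + 1 + g + q
      chain₀ chain₁ : List Triple
      chain₀ = chain X₀ r 0 (suc h)
      chain₁ = chain i r₁ e₁ (suc w)
      lengths : length (chain₀ ++ chain₁) ≡ suc p
      lengths = trans (length-++ chain₀) (trans (cong₂ _+_ (length-chain r X₀ 0 (suc h)) (length-chain r₁ i e₁ (suc w)))
                                                (cong suc (+-suc h w)))
      disjoint : ∀ {t} → ¬ (t ∈ chain₀ × t ∈ chain₁)
      disjoint {_ , _ , _} (t∈₀ , t∈₁) = <⇒≱ (proj₂ (third-∈-chain r t∈₀))
        (≤-trans (≤-trans (m≤m+n (suc h) (h + g + q)) (≤-reflexive (regroup h g q))) (proj₁ (third-∈-chain r₁ t∈₁)))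
        where
        regroup : ∀ h g q → suc h + (h + g + q) ≡ 2 * h + 1 + g + q
        regroup = solve-∀
      solves : ∀ {t} → t ∈ chain₀ ++ chain₁ → value a d t ≡ a * K + d * j + a * i
      solves t∈ with ∈-++⁻ chain₀ t∈
      ... | inj₁ t∈₀ = trans (value-∈-chain r a d t∈₀)
                             (trans (regroup a d g h w r c i) (cong (λ K′ → a * K′ + d * j + a * i) (sym K≡)))
        where
        regroup : ∀ a d g h w r c i → a * (d + 2 * w + g + 1 + c + i + r + 0 + 2 * h) + d * (r + 2 * 0 + 2 * h)
                                      ≡ a * (d + (suc (h + w) + g) + (h + w) + (r + c)) + d * (2 * h + r) + a * i
        regroup = solve-∀
      ... | inj₂ t∈₁ = begin
        value a d _                                                        ≡⟨ value-∈-chain r₁ a d t∈₁ ⟩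
        a * (i + r₁ + e₁ + 2 * w) + d * (r₁ + 2 * e₁ + 2 * w)              ≡⟨ regroup₁ a d i r₁ q h g w ⟩
        a * (r₁ + q + (2 * h + 2 * w + 1 + g + i)) + d * (r₁ + 2 * q + 2 * (2 * h + w + g + 1))
          ≡⟨ cong₂ (λ u v → a * (u + (2 * h + 2 * w + 1 + g + i)) + d * v) (sym carry) (sym j+a≡) ⟩
        a * (r + c + (2 * h + 2 * w + 1 + g + i)) + d * (j + a)            ≡⟨ regroup₂ a d r c h w g i ⟩
        a * (d + (p + g) + (h + w) + (r + c)) + d * j + a * i              ≡⟨ cong (λ K′ → a * K′ + d * j + a * i) K≡ ⟨
        a * K + d * j + a * i                                              ∎
        where
        open ≡-Reasoning
        regroup₁ : ∀ a d i r₁ q h g w → a * (i + r₁ + (2 * h + 1 + g + q) + 2 * w) + d * (r₁ + 2 * (2 * h + 1 + g + q) + 2 * w)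
                                        ≡ a * (r₁ + q + (2 * h + 2 * w + 1 + g + i)) + d * (r₁ + 2 * q + 2 * (2 * h + w + g + 1))
        regroup₁ = solve-∀
        regroup₂ : ∀ a d r c h w g i → a * (r + c + (2 * h + 2 * w + 1 + g + i)) + d * (2 * h + r + a)
                                       ≡ a * (d + (suc (h + w) + g) + (h + w) + (r + c)) + d * (2 * h + r) + a * i
        regroup₂ = solve-∀

    j<a : j < a
    j<a = begin-strict
      2 * h + r               ≤⟨ +-monoʳ-≤ (2 * h) r≤1 ⟩
      2 * h + 1               <⟨ ≤-reflexive (regroup h) ⟩
      2 * (suc h)             ≤⟨ *-monoʳ-≤ 2 (s≤s (≤-trans (m≤m+n h w) (m≤m+n (h + w) g))) ⟩
      2 * (p + g)             ≤⟨ m≤m+n _ ρ ⟩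
      2 * (p + g) + ρ         ≡⟨ a≡ ⟨
      a                       ∎
      where
      open ≤-Reasoning
      regroup : ∀ h → suc (2 * h + 1) ≡ 2 * suc h
      regroup = solve-∀

    private
      degree-regroup : ∀ x y z d t → x + y + z + 2 + d * t ≡ suc (x + y + z + 1 + d * t)
      degree-regroup = solve-∀

    on-chain₀ : ∀ {x y z} → y + 2 * z ≡ j + a * 0 → x + y + z + 1 + d * 0 ≡ K →
                (x , y , z) ∈ chain (d + 2 * w + g + c) r 0 (suc h)
    on-chain₀ {x} {y} {z} weight-eq degree-eq = ∈-chain-of-fibre r r≤1 (inj₂ refl)
      (trans (cong (_+ 2) weight-eq) (weight-regroup a h r))
      (begin
        x + y + z + 2                                  ≡⟨ trans (cong (x + y + z + 2 +_) (*-zeroʳ d)) (+-identityʳ _) ⟨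
        x + y + z + 2 + d * 0                          ≡⟨ degree-regroup x y z d 0 ⟩
        suc (x + y + z + 1 + d * 0)                    ≡⟨ cong suc (trans degree-eq K≡) ⟩
        suc (d + (p + g) + (h + w) + (r + c))          ≡⟨ K-regroup d g h w r c ⟩
        d + 2 * w + g + c + r + 0 + 2 * suc h          ∎)
      where
      open ≡-Reasoning
      weight-regroup : ∀ a h r → 2 * h + r + a * 0 + 2 ≡ r + 2 * (0 + suc h)
      weight-regroup = solve-∀
      K-regroup : ∀ d g h w r c → suc (d + (suc (h + w) + g) + (h + w) + (r + c)) ≡ d + 2 * w + g + c + r + 0 + 2 * suc h
      K-regroup = solve-∀

    on-chain₁ : ∀ {x y z} → y + 2 * z ≡ j + a * 1 → x + y + z + 1 + d * 1 ≡ K →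
                (x , y , z) ∈ chain 0 r₁ (2 * h + 2 + g + q) w
    on-chain₁ {x} {y} {z} weight-eq degree-eq = ∈-chain-of-fibre r₁ r₁≤1 (inj₁ refl)
      (begin
        y + 2 * z + 2                                  ≡⟨ cong (_+ 2) (trans weight-eq (cong (j +_) (*-identityʳ a))) ⟩
        j + a + 2                                      ≡⟨ cong (_+ 2) j+a≡ ⟩
        r₁ + 2 * q + 2 * (2 * h + w + g + 1) + 2       ≡⟨ weight-regroup r₁ q h w g ⟩
        r₁ + 2 * (2 * h + 2 + g + q + w)               ∎)
      (+-cancelʳ-≡ d _ _ (begin
        x + y + z + 2 + d                              ≡⟨ cong (x + y + z + 2 +_) (*-identityʳ d) ⟨
        x + y + z + 2 + d * 1                          ≡⟨ degree-regroup x y z d 1 ⟩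
        suc (x + y + z + 1 + d * 1)                    ≡⟨ cong suc (trans degree-eq K≡) ⟩
        suc (d + (p + g) + (h + w) + (r + c))          ≡⟨ K-regroup d g h w (r + c) ⟩
        2 * h + 2 * w + g + 2 + (r + c) + d            ≡⟨ cong (λ u → 2 * h + 2 * w + g + 2 + u + d) carry ⟩
        2 * h + 2 * w + g + 2 + (r₁ + q) + d           ≡⟨ e₁-regroup h w g r₁ q d ⟩
        0 + r₁ + (2 * h + 2 + g + q) + 2 * w + d       ∎))
      where
      open ≡-Reasoning
      weight-regroup : ∀ r₁ q h w g → r₁ + 2 * q + 2 * (2 * h + w + g + 1) + 2 ≡ r₁ + 2 * (2 * h + 2 + g + q + w)
      weight-regroup = solve-∀
      K-regroup : ∀ d g h w u → suc (d + (suc (h + w) + g) + (h + w) + u) ≡ 2 * h + 2 * w + g + 2 + u + d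
      K-regroup = solve-∀
      e₁-regroup : ∀ h w g r₁ q d → 2 * h + 2 * w + g + 2 + (r₁ + q) + d ≡ 0 + r₁ + (2 * h + 2 + g + q) + 2 * w + d
      e₁-regroup = solve-∀

    far-line-point : ∀ t → 2 * K < j + a * (2 + t) + 2 * (d * (2 + t)) + 2
    far-line-point t = begin-strict
      2 * K                                            ≡⟨ *-distribˡ-+ 2 B (r ⊔ ρ) ⟩
      2 * B + 2 * (r ⊔ ρ)                              ≤⟨ +-monoʳ-≤ (2 * B) (*-monoʳ-≤ 2 (⊔-lub r≤1 ρ≤1)) ⟩
      2 * B + 2 * 1                                    <⟨ n<1+n _ ⟩
      suc (2 * B + 2 * 1)                              ≤⟨ m≤m+n _ (2 * g + 2 * d + 1) ⟩
      suc (2 * B + 2 * 1) + (2 * g + 2 * d + 1)        ≡⟨ regroup d g h w ⟩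
      2 * (p + g) * 2 + 2 * (d * 2) + 2                ≤⟨ +-monoˡ-≤ 2 (+-monoˡ-≤ (2 * (d * 2)) (*-monoˡ-≤ 2 (m≤m+n (2 * (p + g)) ρ))) ⟩
      (2 * (p + g) + ρ) * 2 + 2 * (d * 2) + 2          ≡⟨ cong (λ a′ → a′ * 2 + 2 * (d * 2) + 2) a≡ ⟨
      a * 2 + 2 * (d * 2) + 2                          ≤⟨ +-monoˡ-≤ 2 (+-mono-≤ (m≤n+m _ j) (*-monoʳ-≤ 2 (*-monoʳ-≤ d (m≤m+n 2 t)))) ⟩
      j + a * 2 + 2 * (d * (2 + t)) + 2                ≤⟨ +-monoˡ-≤ 2 (+-monoˡ-≤ _ (+-monoʳ-≤ j (*-monoʳ-≤ a (m≤m+n 2 t)))) ⟩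
      j + a * (2 + t) + 2 * (d * (2 + t)) + 2          ∎
      where
      open ≤-Reasoning
      B : ℕ
      B = d + (p + g) + (h + w)
      regroup : ∀ d g h w → suc (2 * (d + (suc (h + w) + g) + (h + w)) + 2 * 1) + (2 * g + 2 * d + 1)
                            ≡ 2 * (suc (h + w) + g) * 2 + 2 * (d * 2) + 2
      regroup = solve-∀

    below : ∀ {V} i → V + a * suc i ≡ a * K + d * j → repCount a d V ≤ p
    below {V} i V+a[1+i]≡T = subst (repCount a d V ≤_) lengths (repCount-≤ {a} {d} (chain₀ ++ chain₁) i on-chains)
      where
      chain₀ chain₁ : List Triple
      chain₀ = chain (d + 2 * w + g + c) r 0 (suc h)
      chain₁ = chain 0 r₁ (2 * h + 2 + g + q) w
      lengths : length (chain₀ ++ chain₁) ≡ p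
      lengths = trans (length-++ chain₀) (cong₂ _+_ (length-chain r _ 0 (suc h)) (length-chain r₁ 0 _ w))
      on-chains : ∀ {x y z} → value a d (x , y , z) ≡ V → (x + i , y , z) ∈ chain₀ ++ chain₁
      on-chains {x} {y} {z} solves with line-point-below coprime {K} {j} j<a V+a[1+i]≡T solves
      ... | 0 , weight-eq , degree-eq = ∈-++⁺ˡ (on-chain₀ weight-eq degree-eq)
      ... | 1 , weight-eq , degree-eq = ∈-++⁺ʳ chain₀ (on-chain₁ weight-eq degree-eq)
      ... | suc (suc t) , weight-eq , degree-eq =
        ⊥-elim (<⇒≱ (far-line-point t) (line-point-bound {a} {d} {j} {K} {2 + t} {x + i} weight-eq degree-eq))

    isThreshold : IsThreshold a d p (a * K + d * j)
    isThreshold = record { above = above ; below = below }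

  thresholdDegree : (a d p j : ℕ) → ℕ
  thresholdDegree a d p j with 2 * p ≤? j
  ... | yes _ = j / 2 + j % 2 + p
  ... | no  _ = d + a / 2 + pred p + (j % 2 ⊔ a % 2)

  threshold : (a d p j : ℕ) → ℕ
  threshold a d p j = a * thresholdDegree a d p j + d * j

  thresholdDegree-big : ∀ {a d p e r} → r ≤ 1 → thresholdDegree a d p (2 * p + 2 * e + r) ≡ 2 * p + e + r
  thresholdDegree-big {a} {d} {p} {e} {r} r≤1 with 2 * p ≤? 2 * p + 2 * e + r
  ... | yes _ = trans (cong₂ (λ h r′ → h + r′ + p) (proj₂ j-halves) (proj₁ j-halves)) (K-regroup p e r)
    where
    j-regroup : ∀ p e r → 2 * p + 2 * e + r ≡ 2 * (p + e) + r
    j-regroup = solve-∀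
    K-regroup : ∀ p e r → p + e + r + p ≡ 2 * p + e + r
    K-regroup = solve-∀
    j-halves : (2 * p + 2 * e + r) % 2 ≡ r × (2 * p + 2 * e + r) / 2 ≡ p + e
    j-halves = halves r≤1 (j-regroup p e r)
  ... | no 2p≰j = ⊥-elim (2p≰j (≤-trans (m≤m+n (2 * p) (2 * e)) (m≤m+n _ r)))

  thresholdDegree-small : ∀ {a d p h r} → h < p → r ≤ 1 → thresholdDegree a d p (2 * h + r) ≡ d + a / 2 + pred p + (r ⊔ a % 2)
  thresholdDegree-small {a} {d} {p} {h} {r} h<p r≤1 with 2 * p ≤? 2 * h + r
  ... | no _ = cong (λ r′ → d + a / 2 + pred p + (r′ ⊔ a % 2)) (proj₁ (halves {2 * h + r} {h} r≤1 refl))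
  ... | yes 2p≤j = ⊥-elim (<⇒≱ (begin-strict
    2 * h + r     ≤⟨ +-monoʳ-≤ (2 * h) r≤1 ⟩
    2 * h + 1     <⟨ ≤-reflexive (regroup h) ⟩
    2 * suc h     ≤⟨ *-monoʳ-≤ 2 h<p ⟩
    2 * p         ∎) 2p≤j)
    where
    open ≤-Reasoning
    regroup : ∀ h → suc (2 * h + 1) ≡ 2 * suc h
    regroup = solve-∀

  module _ {a d : ℕ} .{{_ : NonZero a}} (coprime : Coprime a d) {p g ρ : ℕ} (a≡ : a ≡ 2 * (p + g) + ρ) (ρ≤1 : ρ ≤ 1) where

    threshold-isThreshold : ∀ {j} → j < a → IsThreshold a d p (threshold a d p j)
    threshold-isThreshold {j} j<a = subst (λ j → IsThreshold a d p (threshold a d p j)) (sym j≡2h+r)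
      (by-half r≤1 (subst (_< a) j≡2h+r j<a) (j / 2 <? p))
      where
      r≤1 : j % 2 ≤ 1
      r≤1 = proj₁ (parity-decomposition j)
      j≡2h+r : j ≡ 2 * (j / 2) + j % 2
      j≡2h+r = trans (proj₂ (parity-decomposition j)) (+-comm (j % 2) _)
      by-half : ∀ {h r} → r ≤ 1 → 2 * h + r < a → Dec (h < p) → IsThreshold a d p (threshold a d p (2 * h + r))
      by-half {h} {r} r≤1 j<a (no h≮p) with m≤n⇒∃[o]m+o≡n (≮⇒≥ h≮p)
      ... | e , refl = subst (λ j → IsThreshold a d p (threshold a d p j)) (sym j≡)
        (subst (IsThreshold a d p) (cong (λ K → a * K + d * (2 * p + 2 * e + r)) (sym (thresholdDegree-big {a} {d} {p} {e} r≤1)))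
          (BigCase.isThreshold coprime {p} {e} {r} r≤1 (subst (_< a) j≡ j<a)))
        where
        j≡ : 2 * (p + e) + r ≡ 2 * p + 2 * e + r
        j≡ = cong (_+ r) (*-distribˡ-+ 2 p e)
      by-half {h} {r} r≤1 j<a (yes h<p) with m≤n⇒∃[o]m+o≡n h<p
      ... | w , refl with half-adder r≤1 ρ≤1 | halves ρ≤1 a≡
      ... | r₁ , q , c , r₁≤1 , sum-bit , max-bit , carry | a%2≡ρ , a/2≡p+g =
        subst (IsThreshold a d p) (cong (λ K → a * K + d * (2 * h + r)) (sym K≡))
          (SmallCase.isThreshold coprime {g} {h} {w} a≡ r≤1 ρ≤1 r₁≤1 sum-bit max-bit carry)
        where
        K≡ : thresholdDegree a d p (2 * h + r) ≡ d + (p + g) + (h + w) + (r ⊔ ρ)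
        K≡ = trans (thresholdDegree-small h<p r≤1) (cong₂ (λ m ρ′ → d + m + (h + w) + (r ⊔ ρ′)) a/2≡p+g a%2≡ρ)

module FiniteSums where

  open Representations using (⊆-length⇒⊇)
  open import Data.Nat
  open import Data.Nat.Properties
  open import Data.Nat.Tactic.RingSolver using (solve-∀)
  open import Data.Nat.DivMod using (m%n<n)
  open Residues using (m≡n*[m/n]+m%n; m≤n*o⇒m/n≤o)
  open import Data.Bool using (true; false; if_then_else_)
  open import Data.List using (List; []; _∷_; _++_; map; filter; upTo; [_])
  open import Data.List.Properties using (length-map; length-upTo; map-∘; map-++; upTo-∷ʳ)
  open import Data.Nat.ListAction using (sum)
  open import Data.Nat.ListAction.Properties using (sum-++; sum-↭)
  open import Data.List.Membership.Propositional.Properties using (∈-map⁻; ∈-upTo⁺; ∈-upTo⁻)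
  open import Data.List.Membership.Propositional.Properties.WithK using (unique∧set⇒bag)
  open import Data.List.Relation.Binary.BagAndSetEquality using (∼bag⇒↭)
  open import Data.List.Relation.Binary.Permutation.Propositional using (_↭_)
  import Data.List.Relation.Binary.Permutation.Propositional.Properties as Permutation
  open import Data.List.Relation.Binary.Subset.Propositional using (_⊆_)
  open import Data.List.Relation.Unary.Unique.Propositional using (Unique)
  import Data.List.Relation.Unary.Unique.Propositional.Properties as Unique
  import Data.List.Relation.Unary.AllPairs.Properties as AllPairs
  open import Data.Product using (_×_; _,_; ∃)
  open import Function.Bundles using (mk⇔)
  open import Relation.Binary.PropositionalEquality hiding ([_])
  open import Function.Base using (_∘_; id)
  open import Relation.Nullary using (does; yes; no)
  open import Relation.Unary using (Decidable)

  ∑ : ℕ → (ℕ → ℕ) → ℕ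
  ∑ zero f = 0
  ∑ (suc n) f = ∑ n f + f n

  ∑-cong : ∀ n {f g} → (∀ i → i < n → f i ≡ g i) → ∑ n f ≡ ∑ n g
  ∑-cong zero f≗g = refl
  ∑-cong (suc n) f≗g = cong₂ _+_ (∑-cong n (λ i i<n → f≗g i (m<n⇒m<1+n i<n))) (f≗g n (n<1+n n))

  ∑-+ : ∀ n f g → ∑ n (λ i → f i + g i) ≡ ∑ n f + ∑ n g
  ∑-+ zero f g = refl
  ∑-+ (suc n) f g = trans (cong (_+ (f n + g n)) (∑-+ n f g)) (+-interchange (∑ n f) (∑ n g) (f n) (g n))
    where
    +-interchange : ∀ x y z w → x + y + (z + w) ≡ x + z + (y + w)
    +-interchange = solve-∀

  ∑-* : ∀ n k f → ∑ n (λ i → k * f i) ≡ k * ∑ n f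
  ∑-* zero k f = sym (*-zeroʳ k)
  ∑-* (suc n) k f = trans (cong (_+ k * f n) (∑-* n k f)) (sym (*-distribˡ-+ k (∑ n f) (f n)))

  ∑-zero : ∀ n → ∑ n (λ _ → 0) ≡ 0
  ∑-zero zero = refl
  ∑-zero (suc n) = trans (+-identityʳ _) (∑-zero n)

  ∑-split : ∀ m n f → ∑ (m + n) f ≡ ∑ m f + ∑ n (λ i → f (m + i))
  ∑-split m zero f = trans (cong (λ k → ∑ k f) (+-identityʳ m)) (sym (+-identityʳ _))
  ∑-split m (suc n) f = trans (cong (λ k → ∑ k f) (+-suc m n))
    (trans (cong (_+ f (m + n)) (∑-split m n f)) (+-assoc (∑ m f) _ _))

  ∑≡sum-upTo : ∀ n f → ∑ n f ≡ sum (map f (upTo n))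
  ∑≡sum-upTo zero f = refl
  ∑≡sum-upTo (suc n) f = begin
    ∑ n f + f n                                ≡⟨ cong₂ _+_ (∑≡sum-upTo n f) (sym (+-identityʳ (f n))) ⟩
    sum (map f (upTo n)) + sum [ f n ]         ≡⟨ sum-++ (map f (upTo n)) [ f n ] ⟨
    sum (map f (upTo n) ++ [ f n ])            ≡⟨ cong sum (map-++ f (upTo n) [ n ]) ⟨
    sum (map f (upTo n ++ [ n ]))              ≡⟨ cong (sum ∘ map f) (upTo-∷ʳ n) ⟩
    sum (map f (upTo (suc n)))                 ∎
    where open ≡-Reasoning

  ∑-by-residue : ∀ a Q F → ∑ (a * Q) F ≡ ∑ a (λ c → ∑ Q (λ q → F (a * q + c)))
  ∑-by-residue a zero F = trans (cong (λ k → ∑ k F) (*-zeroʳ a)) (sym (∑-zero a))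
  ∑-by-residue a (suc Q) F = begin
    ∑ (a * suc Q) F                                                     ≡⟨ cong (λ k → ∑ k F) (trans (*-suc a Q) (+-comm a (a * Q))) ⟩
    ∑ (a * Q + a) F                                                     ≡⟨ ∑-split (a * Q) a F ⟩
    ∑ (a * Q) F + ∑ a (λ c → F (a * Q + c))                             ≡⟨ cong (_+ ∑ a (λ c → F (a * Q + c))) (∑-by-residue a Q F) ⟩
    ∑ a (λ c → ∑ Q (λ q → F (a * q + c))) + ∑ a (λ c → F (a * Q + c))  ≡⟨ ∑-+ a _ _ ⟨
    ∑ a (λ c → ∑ (suc Q) (λ q → F (a * q + c)))                         ∎
    where open ≡-Reasoning

  ∑-evens-odds : ∀ n f → ∑ (2 * n) f ≡ ∑ n (λ e → f (2 * e)) + ∑ n (λ e → f (2 * e + 1))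
  ∑-evens-odds zero f = refl
  ∑-evens-odds (suc n) f = begin
    ∑ (2 * suc n) f                                   ≡⟨ cong (λ k → ∑ k f) (regroup n) ⟩
    ∑ (2 * n) f + f (2 * n) + f (suc (2 * n))         ≡⟨ cong (λ j → ∑ (2 * n) f + f (2 * n) + f j) (+-comm 1 (2 * n)) ⟩
    ∑ (2 * n) f + f (2 * n) + f (2 * n + 1)           ≡⟨ cong (λ s → s + f (2 * n) + f (2 * n + 1)) (∑-evens-odds n f) ⟩
    E + O + f (2 * n) + f (2 * n + 1)                 ≡⟨ interchange E O (f (2 * n)) (f (2 * n + 1)) ⟩
    (E + f (2 * n)) + (O + f (2 * n + 1))             ∎
    where
    open ≡-Reasoning
    E O : ℕ
    E = ∑ n (λ e → f (2 * e))
    O = ∑ n (λ e → f (2 * e + 1))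
    regroup : ∀ n → 2 * suc n ≡ suc (suc (2 * n))
    regroup = solve-∀
    interchange : ∀ x y z w → x + y + z + w ≡ (x + z) + (y + w)
    interchange = solve-∀

  ∑-by-parity : ∀ n ρ f → ρ ≤ 1 → ∑ (2 * n + ρ) f ≡ ∑ (n + ρ) (λ e → f (2 * e)) + ∑ n (λ e → f (2 * e + 1))
  ∑-by-parity n zero f _ = trans (cong (λ k → ∑ k f) (+-identityʳ (2 * n)))
    (trans (∑-evens-odds n f) (cong (λ k → ∑ k (λ e → f (2 * e)) + ∑ n (λ e → f (2 * e + 1))) (sym (+-identityʳ n))))
  ∑-by-parity n (suc zero) f _ = begin
    ∑ (2 * n + 1) f                                     ≡⟨ cong (λ k → ∑ k f) (+-comm (2 * n) 1) ⟩
    ∑ (2 * n) f + f (2 * n)                             ≡⟨ cong (_+ f (2 * n)) (∑-evens-odds n f) ⟩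
    E + O + f (2 * n)                                   ≡⟨ +-interchange E O (f (2 * n)) ⟩
    ∑ (suc n) (λ e → f (2 * e)) + O                     ≡⟨ cong (λ k → ∑ k (λ e → f (2 * e)) + O) (+-comm 1 n) ⟩
    ∑ (n + 1) (λ e → f (2 * e)) + O                     ∎
    where
    open ≡-Reasoning
    E O : ℕ
    E = ∑ n (λ e → f (2 * e))
    O = ∑ n (λ e → f (2 * e + 1))
    +-interchange : ∀ x y z → x + y + z ≡ x + z + y
    +-interchange = solve-∀
  ∑-by-parity n (suc (suc _)) f (s≤s ())

  ∑-truncate : ∀ Q M f g → M ≤ Q → (∀ q → q < M → f q ≡ g q) → (∀ q → M ≤ q → q < Q → f q ≡ 0) → ∑ Q f ≡ ∑ M g
  ∑-truncate zero zero f g _ _ _ = refl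
  ∑-truncate (suc Q) M f g M≤1+Q f≗g f≗0 with M ≟ suc Q
  ... | yes refl = ∑-cong (suc Q) f≗g
  ... | no M≢1+Q = trans (cong (∑ Q f +_) (f≗0 Q M≤Q ≤-refl))
    (trans (+-identityʳ _) (∑-truncate Q M f g M≤Q f≗g (λ q M≤q q<Q → f≗0 q M≤q (m<n⇒m<1+n q<Q))))
    where
    M≤Q : M ≤ Q
    M≤Q = ≤-pred (≤∧≢⇒< M≤1+Q M≢1+Q)

  ∑-arithmetic : ∀ a c M → 2 * ∑ M (λ q → a * q + c) + a * M ≡ a * M * M + 2 * M * c
  ∑-arithmetic a c zero = base a c
    where
    base : ∀ a c → 2 * 0 + a * 0 ≡ a * 0 * 0 + 2 * 0 * c
    base = solve-∀
  ∑-arithmetic a c (suc M) = +-cancelʳ-≡ (a * M * M + 2 * M * c) _ _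
    (trans (step a c M (∑ M (λ q → a * q + c))) (cong (a * suc M * suc M + 2 * suc M * c +_) (∑-arithmetic a c M)))
    where
    step : ∀ a c M X → 2 * (X + (a * M + c)) + a * suc M + (a * M * M + 2 * M * c)
                       ≡ a * suc M * suc M + 2 * suc M * c + (2 * X + a * M)
    step = solve-∀

  sum-filter : ∀ {P : ℕ → Set} (P? : Decidable P) xs →
               sum (filter P? xs) ≡ sum (map (λ m → if does (P? m) then m else 0) xs)
  sum-filter P? [] = refl
  sum-filter P? (x ∷ xs) with does (P? x)
  ... | true = cong (x +_) (sum-filter P? xs)
  ... | false = sum-filter P? xs

  module _ {a : ℕ} {σ : ℕ → ℕ} (σ<a : ∀ {j} → j < a → σ j < a)
           (σ-injective : ∀ {i j} → i < a → j < a → σ i ≡ σ j → i ≡ j) where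

    private
      images : List ℕ
      images = map σ (upTo a)

      unique-images : Unique images
      unique-images = AllPairs.map⁺ (AllPairs.applyUpTo⁺₁ id a
        λ i<j j<a σi≡σj → <⇒≢ i<j (σ-injective (<-trans i<j j<a) j<a σi≡σj))

      images⊆ : images ⊆ upTo a
      images⊆ c∈ with ∈-map⁻ σ c∈
      ... | j , j∈ , refl = ∈-upTo⁺ (σ<a (∈-upTo⁻ j∈))

      ⊆images : upTo a ⊆ images
      ⊆images = ⊆-length⇒⊇ _≟_ unique-images images⊆
        (≤-reflexive (trans (length-upTo a) (sym (trans (length-map σ (upTo a)) (length-upTo a)))))

    σ-onto : ∀ {c} → c < a → ∃ λ j → j < a × σ j ≡ c
    σ-onto c<a with ∈-map⁻ σ (⊆images (∈-upTo⁺ c<a))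
    ... | j , j∈ , c≡σj = j , ∈-upTo⁻ j∈ , sym c≡σj

    ∑-permute : ∀ f → ∑ a (f ∘ σ) ≡ ∑ a f
    ∑-permute f = begin
      ∑ a (f ∘ σ)                   ≡⟨ ∑≡sum-upTo a (f ∘ σ) ⟩
      sum (map (f ∘ σ) (upTo a))    ≡⟨ cong sum (map-∘ (upTo a)) ⟩
      sum (map f images)            ≡⟨ sum-↭ (Permutation.map⁺ f images↭) ⟩
      sum (map f (upTo a))          ≡⟨ ∑≡sum-upTo a f ⟨
      ∑ a f                         ∎
      where
      open ≡-Reasoning
      images↭ : images ↭ upTo a
      images↭ = ∼bag⇒↭ (unique∧set⇒bag unique-images (Unique.upTo⁺ a) (mk⇔ images⊆ ⊆images))

  -- Selmer's formula 2 a ∑ F = ∑ T_j² − ∑ c² − a (∑ T_j − ∑ c), with the subtracted terms moved across.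
  module Selmer {a : ℕ} .{{_ : NonZero a}} (T : ℕ → ℕ)
    (residues-distinct : ∀ {i j} → i < a → j < a → T i % a ≡ T j % a → i ≡ j)
    (Q : ℕ) (T≤aQ : ∀ {j} → j < a → T j ≤ a * Q) (F : ℕ → ℕ)
    (F-below : ∀ {j q} → j < a → q < T j / a → F (a * q + T j % a) ≡ a * q + T j % a)
    (F-above : ∀ {j q} → j < a → T j / a ≤ q → F (a * q + T j % a) ≡ 0) where

    private
      σ M : ℕ → ℕ
      σ j = T j % a
      M j = T j / a

      T≡ : ∀ j → T j ≡ a * M j + σ j
      T≡ j = m≡n*[m/n]+m%n (T j) a

      M≤Q : ∀ {j} → j < a → M j ≤ Q
      M≤Q j<a = m≤n*o⇒m/n≤o (T≤aQ j<a)

      Ψ : ℕ → ℕ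
      Ψ j = ∑ (M j) (λ q → a * q + σ j)

      permute : ∀ f → ∑ a (f ∘ σ) ≡ ∑ a f
      permute = ∑-permute (λ {j} _ → m%n<n (T j) a) residues-distinct

      ∑F≡∑Ψ : ∑ (a * Q) F ≡ ∑ a Ψ
      ∑F≡∑Ψ = begin
        ∑ (a * Q) F                                    ≡⟨ ∑-by-residue a Q F ⟩
        ∑ a (λ c → ∑ Q (λ q → F (a * q + c)))          ≡⟨ permute (λ c → ∑ Q (λ q → F (a * q + c))) ⟨
        ∑ a (λ j → ∑ Q (λ q → F (a * q + σ j)))        ≡⟨ ∑-cong a (λ j j<a → ∑-truncate Q (M j) _ _ (M≤Q j<a)
                                                            (λ q q<M → F-below j<a q<M) (λ q M≤q _ → F-above j<a M≤q)) ⟩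
        ∑ a Ψ                                          ∎
        where open ≡-Reasoning

      -- a (2 Ψ_j) = T_j² − σ_j² − a (T_j − σ_j), stated without subtraction
      class-identity : ∀ j → a * (2 * Ψ j) + σ j * σ j + a * T j ≡ T j * T j + a * σ j
      class-identity j = begin
        a * (2 * Ψ j) + σ j * σ j + a * T j                   ≡⟨ cong (λ t → a * (2 * Ψ j) + σ j * σ j + a * t) (T≡ j) ⟩
        a * (2 * Ψ j) + σ j * σ j + a * (a * M j + σ j)
          ≡⟨ +-cancelʳ-≡ (a * (a * M j * M j + 2 * M j * σ j)) _ _
               (trans (regroup a (M j) (σ j) (Ψ j))
                      (cong (λ u → (a * M j + σ j) * (a * M j + σ j) + a * σ j + a * u) (∑-arithmetic a (σ j) (M j)))) ⟩
        (a * M j + σ j) * (a * M j + σ j) + a * σ j           ≡⟨ cong (λ t → t * t + a * σ j) (T≡ j) ⟨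
        T j * T j + a * σ j                                   ∎
        where
        open ≡-Reasoning
        regroup : ∀ a M c X → a * (2 * X) + c * c + a * (a * M + c) + a * (a * M * M + 2 * M * c)
                              ≡ (a * M + c) * (a * M + c) + a * c + a * (2 * X + a * M)
        regroup = solve-∀

    selmer : 2 * a * ∑ (a * Q) F + ∑ a (λ c → c * c) + a * ∑ a T ≡ ∑ a (λ j → T j * T j) + a * ∑ a id
    selmer = begin
      2 * a * ∑ (a * Q) F + ∑ a (λ c → c * c) + a * ∑ a T
        ≡⟨ cong₂ (λ u v → 2 * a * u + v + a * ∑ a T) ∑F≡∑Ψ (sym (permute (λ c → c * c))) ⟩
      2 * a * ∑ a Ψ + ∑ a (λ j → σ j * σ j) + a * ∑ a T
        ≡⟨ cong₂ (λ u v → u + ∑ a (λ j → σ j * σ j) + v) ∑a2Ψ (∑-* a a T) ⟨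
      ∑ a (λ j → a * (2 * Ψ j)) + ∑ a (λ j → σ j * σ j) + ∑ a (λ j → a * T j)
        ≡⟨ trans (∑-+ a (λ j → a * (2 * Ψ j) + σ j * σ j) (λ j → a * T j))
                 (cong (_+ ∑ a (λ j → a * T j)) (∑-+ a (λ j → a * (2 * Ψ j)) (λ j → σ j * σ j))) ⟨
      ∑ a (λ j → a * (2 * Ψ j) + σ j * σ j + a * T j)
        ≡⟨ ∑-cong a (λ j _ → class-identity j) ⟩
      ∑ a (λ j → T j * T j + a * σ j)
        ≡⟨ ∑-+ a _ _ ⟩
      ∑ a (λ j → T j * T j) + ∑ a (λ j → a * σ j)
        ≡⟨ cong (∑ a (λ j → T j * T j) +_) (trans (∑-* a a σ) (cong (a *_) (permute id))) ⟩
      ∑ a (λ j → T j * T j) + a * ∑ a id ∎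
      where
      open ≡-Reasoning
      ∑a2Ψ : ∑ a (λ j → a * (2 * Ψ j)) ≡ 2 * a * ∑ a Ψ
      ∑a2Ψ = begin
        ∑ a (λ j → a * (2 * Ψ j))   ≡⟨ ∑-* a a (λ j → 2 * Ψ j) ⟩
        a * ∑ a (λ j → 2 * Ψ j)     ≡⟨ cong (a *_) (∑-* a 2 Ψ) ⟩
        a * (2 * ∑ a Ψ)             ≡⟨ *-assoc a 2 (∑ a Ψ) ⟨
        a * 2 * ∑ a Ψ               ≡⟨ cong (_* ∑ a Ψ) (*-comm a 2) ⟩
        2 * a * ∑ a Ψ               ∎

module SylvesterSum where

  open import Defs
  open Representations
  open Residues
  open Thresholds
  open FiniteSums
  open import Data.Nat
  open import Data.Nat.Properties
  open import Data.Nat.DivMod using (m%n<n; m/n≤m; [m+kn]%n≡m%n)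
  open import Data.Nat.Tactic.RingSolver using (solve-∀)
  open import Data.Nat.Coprimality using (Coprime)
  open import Data.Bool using (if_then_else_)
  open import Data.List using (upTo)
  open import Data.Product using (_,_; proj₁)
  open import Function.Base using (id)
  open import Relation.Binary.PropositionalEquality
  open import Relation.Nullary using (does; yes; no)
  open import Relation.Nullary.Decidable using (dec-true; dec-false)

  thresholdDegree-≤ : ∀ {a d p j} → j < a → thresholdDegree a d p j ≤ d + a + p + 1
  thresholdDegree-≤ {a} {d} {p} {j} j<a with 2 * p ≤? j
  ... | yes _ = begin
    j / 2 + j % 2 + p     ≤⟨ +-monoˡ-≤ p (+-mono-≤ (≤-trans (m/n≤m j 2) (<⇒≤ j<a)) (proj₁ (parity-decomposition j))) ⟩
    a + 1 + p             ≤⟨ m≤n+m _ d ⟩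
    d + (a + 1 + p)       ≡⟨ regroup d a p ⟩
    d + a + p + 1         ∎
    where
    open ≤-Reasoning
    regroup : ∀ d a p → d + (a + 1 + p) ≡ d + a + p + 1
    regroup = solve-∀
  ... | no _ = +-mono-≤ (+-mono-≤ (+-monoʳ-≤ d (m/n≤m a 2)) pred[n]≤n)
                        (⊔-lub (proj₁ (parity-decomposition j)) (proj₁ (parity-decomposition a)))

  threshold-≤ : ∀ {a d p j} → j < a → threshold a d p j ≤ a * (a + 2 * d + p + 1)
  threshold-≤ {a} {d} {p} {j} j<a = begin
    a * K + d * j                   ≤⟨ +-monoʳ-≤ (a * K) (*-monoʳ-≤ d (<⇒≤ j<a)) ⟩
    a * K + d * a                   ≡⟨ cong (a * K +_) (*-comm d a) ⟩
    a * K + a * d                   ≡⟨ *-distribˡ-+ a K d ⟨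
    a * (K + d)                     ≤⟨ *-monoʳ-≤ a (+-monoˡ-≤ d (thresholdDegree-≤ {a} {d} {p} j<a)) ⟩
    a * (d + a + p + 1 + d)         ≡⟨ cong (a *_) (regroup d a p) ⟩
    a * (a + 2 * d + p + 1)         ∎
    where
    open ≤-Reasoning
    K : ℕ
    K = thresholdDegree a d p j
    regroup : ∀ d a p → d + a + p + 1 + d ≡ a + 2 * d + p + 1
    regroup = solve-∀

  threshold-residue : ∀ {a d p} .{{_ : NonZero a}} j → threshold a d p j % a ≡ (d * j) % a
  threshold-residue {a} {d} {p} j = trans (cong (_% a) (+-comm (a * K) (d * j)))
    (trans (cong (λ u → (d * j + u) % a) (*-comm a K)) ([m+kn]%n≡m%n (d * j) K a))
    where
    K : ℕ
    K = thresholdDegree a d p j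

  module Sylvester {a d : ℕ} .{{_ : NonZero a}} (coprime : Coprime a d)
    {p g ρ : ℕ} (a≡ : a ≡ 2 * (p + g) + ρ) (ρ≤1 : ρ ≤ 1) where

    Q : ℕ
    Q = a + 2 * d + p + 1

    T : ℕ → ℕ
    T = threshold a d p

    private
      σ : ℕ → ℕ
      σ j = T j % a

      residues-distinct : ∀ {i j} → i < a → j < a → σ i ≡ σ j → i ≡ j
      residues-distinct {i} {j} i<a j<a σi≡σj =
        *-%-injective coprime i<a j<a (trans (sym (threshold-residue {a} {d} {p} i)) (trans σi≡σj (threshold-residue {a} {d} {p} j)))

      F : ℕ → ℕ
      F m = if does (repCount a d m ≤? p) then m else 0

      F-yes : ∀ {m} → repCount a d m ≤ p → F m ≡ m
      F-yes {m} rep≤p = cong (λ b → if b then m else 0) (dec-true (repCount a d m ≤? p) rep≤p)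

      F-no : ∀ {m} → p < repCount a d m → F m ≡ 0
      F-no {m} p<rep = cong (λ b → if b then m else 0) (dec-false (repCount a d m ≤? p) (<⇒≱ p<rep))

      isThreshold : ∀ {j} → j < a → IsThreshold a d p (T j)
      isThreshold = threshold-isThreshold coprime a≡ ρ≤1

      F-below : ∀ {j q} → j < a → q < T j / a → F (a * q + σ j) ≡ a * q + σ j
      F-below {j} {q} j<a q<M with m≤n⇒∃[o]m+o≡n q<M
      ... | i , 1+q+i≡M = F-yes (IsThreshold.below (isThreshold j<a) i (begin
        a * q + σ j + a * suc i     ≡⟨ regroup a q (σ j) i ⟩
        a * (suc q + i) + σ j       ≡⟨ cong (λ M → a * M + σ j) 1+q+i≡M ⟩
        a * (T j / a) + σ j         ≡⟨ m≡n*[m/n]+m%n (T j) a ⟨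
        T j                         ∎))
        where
        open ≡-Reasoning
        regroup : ∀ a q s i → a * q + s + a * suc i ≡ a * (suc q + i) + s
        regroup = solve-∀

      T+a*i≡ : ∀ j i → a * (T j / a + i) + σ j ≡ T j + a * i
      T+a*i≡ j i = trans (regroup a (T j / a) i (σ j)) (cong (_+ a * i) (sym (m≡n*[m/n]+m%n (T j) a)))
        where
        regroup : ∀ a M i s → a * (M + i) + s ≡ a * M + s + a * i
        regroup = solve-∀

      F-above : ∀ {j q} → j < a → T j / a ≤ q → F (a * q + σ j) ≡ 0
      F-above {j} j<a M≤q with m≤n⇒∃[o]m+o≡n M≤q
      ... | i , refl = F-no (subst (λ n → p < repCount a d n) (sym (T+a*i≡ j i)) (IsThreshold.above (isThreshold j<a) i))

      sylvesterSum≡∑ : ∀ N → sylvesterSumBelow a d p N ≡ ∑ N F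
      sylvesterSum≡∑ N = trans (sum-filter (λ m → repCount a d m ≤? p) (upTo N)) (sym (∑≡sum-upTo N F))

    selmer-identity : 2 * a * sylvesterSumBelow a d p (a * Q) + ∑ a (λ c → c * c) + a * ∑ a T
                      ≡ ∑ a (λ j → T j * T j) + a * ∑ a id
    selmer-identity = trans (cong (λ s → 2 * a * s + ∑ a (λ c → c * c) + a * ∑ a T) (sylvesterSum≡∑ (a * Q)))
      (Selmer.selmer T residues-distinct Q (threshold-≤ {a} {d} {p}) F F-below F-above)

    beyond-aQ : ∀ n → a * Q ≤ n → p < repCount a d n
    beyond-aQ n aQ≤n with σ-onto (λ {j} _ → m%n<n (T j) a) residues-distinct (m%n<n n a)
    ... | j , j<a , σj≡n%a with m≤n⇒∃[o]m+o≡n (≤-trans (m≤n*o⇒m/n≤o (threshold-≤ {a} {d} {p} j<a)) (n*o≤m⇒o≤m/n aQ≤n))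
    ... | i , M+i≡n/a = subst (λ n → p < repCount a d n) n≡ (IsThreshold.above (isThreshold j<a) i)
      where
      n≡ : T j + a * i ≡ n
      n≡ = begin
        T j + a * i                 ≡⟨ T+a*i≡ j i ⟨
        a * (T j / a + i) + σ j     ≡⟨ cong₂ (λ q c → a * q + c) M+i≡n/a σj≡n%a ⟩
        a * (n / a) + n % a         ≡⟨ m≡n*[m/n]+m%n n a ⟨
        n                           ∎
        where open ≡-Reasoning

module ClosedForm where

  open import Defs
  open Representations using (halves)
  open Thresholds
  open FiniteSums
  open SylvesterSum
  open import Data.Nat as ℕ using (ℕ; zero; suc; _≤_; _<_; _⊔_; z≤n; s≤s)
  import Data.Nat.Properties as ℕ
  open import Data.Integer using (ℤ; +_; _+_; _-_; _*_)
  open import Data.Integer.Properties using (pos-+; pos-*; *-cancelˡ-≡)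
  open import Data.Integer.Tactic.RingSolver using (solve-∀)
  open import Relation.Binary.PropositionalEquality
  open import Data.Nat.Coprimality using (Coprime)
  open import Data.Product using (proj₁; proj₂)
  open import Function.Base using (_∘_; id)

  -- twice the sum U + (U + V) + … + (U + (n − 1) V)
  apSum : ℤ → ℤ → ℤ → ℤ
  apSum n U V = + 2 * n * U + V * (n * n - n)

  -- six times the sum U² + (U + V)² + … + (U + (n − 1) V)²
  apSquareSum : ℤ → ℤ → ℤ → ℤ
  apSquareSum n U V = + 6 * n * U * U + + 6 * U * V * (n * n - n) + V * V * (+ 2 * n * n * n - + 3 * n * n + n)

  module _ (f : ℕ → ℕ) (U V : ℤ) where

    ∑-ap : ∀ n → (∀ h → h < n → + f h ≡ U + V * + h) → + 2 * + ∑ n f ≡ apSum (+ n) U V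
    ∑-ap zero _ = base U V
      where
      base : ∀ U V → + 0 ≡ + 2 * + 0 * U + V * (+ 0 * + 0 - + 0)
      base = solve-∀
    ∑-ap (suc n) f-ap = begin
      + 2 * + (∑ n f ℕ.+ f n)                         ≡⟨ cong (+ 2 *_) (trans (pos-+ (∑ n f) (f n)) (cong (λ x → + ∑ n f + x) (f-ap n (ℕ.n<1+n n)))) ⟩
      + 2 * (+ ∑ n f + (U + V * + n))                 ≡⟨ split (+ ∑ n f) (U + V * + n) ⟩
      + 2 * + ∑ n f + + 2 * (U + V * + n)             ≡⟨ cong (_+ + 2 * (U + V * + n)) (∑-ap n (λ h h<n → f-ap h (ℕ.m<n⇒m<1+n h<n))) ⟩
      apSum (+ n) U V + + 2 * (U + V * + n)           ≡⟨ step U V (+ n) ⟩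
      apSum (+ suc n) U V                             ∎
      where
      open ≡-Reasoning
      split : ∀ x y → + 2 * (x + y) ≡ + 2 * x + + 2 * y
      split = solve-∀
      step : ∀ U V n → + 2 * n * U + V * (n * n - n) + + 2 * (U + V * n)
                       ≡ + 2 * (+ 1 + n) * U + V * ((+ 1 + n) * (+ 1 + n) - (+ 1 + n))
      step = solve-∀

    ∑-ap² : ∀ n → (∀ h → h < n → + f h ≡ U + V * + h) → + 6 * + ∑ n (λ h → f h ℕ.* f h) ≡ apSquareSum (+ n) U V
    ∑-ap² zero _ = base U V
      where
      base : ∀ U V → + 0 ≡ + 6 * + 0 * U * U + + 6 * U * V * (+ 0 * + 0 - + 0) + V * V * (+ 2 * + 0 * + 0 * + 0 - + 3 * + 0 * + 0 + + 0)
      base = solve-∀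
    ∑-ap² (suc n) f-ap = begin
      + 6 * + (∑ n f² ℕ.+ f n ℕ.* f n)                ≡⟨ cong (+ 6 *_) (trans (pos-+ (∑ n f²) (f n ℕ.* f n))
                                                            (cong (λ x → + ∑ n f² + x) (trans (pos-* (f n) (f n)) (cong₂ _*_ fn fn)))) ⟩
      + 6 * (+ ∑ n f² + (U + V * + n) * (U + V * + n)) ≡⟨ split (+ ∑ n f²) ((U + V * + n) * (U + V * + n)) ⟩
      + 6 * + ∑ n f² + + 6 * ((U + V * + n) * (U + V * + n))
                                                      ≡⟨ cong (_+ + 6 * ((U + V * + n) * (U + V * + n))) (∑-ap² n (λ h h<n → f-ap h (ℕ.m<n⇒m<1+n h<n))) ⟩
      apSquareSum (+ n) U V + + 6 * ((U + V * + n) * (U + V * + n))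
                                                      ≡⟨ step U V (+ n) ⟩
      apSquareSum (+ suc n) U V                       ∎
      where
      open ≡-Reasoning
      f² : ℕ → ℕ
      f² h = f h ℕ.* f h
      fn : + f n ≡ U + V * + n
      fn = f-ap n (ℕ.n<1+n n)
      split : ∀ x y → + 6 * (x + y) ≡ + 6 * x + + 6 * y
      split = solve-∀
      step : ∀ U V n → + 6 * n * U * U + + 6 * U * V * (n * n - n) + V * V * (+ 2 * n * n * n - + 3 * n * n + n)
                       + + 6 * ((U + V * n) * (U + V * n))
                       ≡ + 6 * (+ 1 + n) * U * U + + 6 * U * V * ((+ 1 + n) * (+ 1 + n) - (+ 1 + n))
                         + V * V * (+ 2 * (+ 1 + n) * (+ 1 + n) * (+ 1 + n) - + 3 * (+ 1 + n) * (+ 1 + n) + (+ 1 + n))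
      step = solve-∀

  +-cast : ∀ {a p g ρ} → a ≡ 2 ℕ.* (p ℕ.+ g) ℕ.+ ρ → + a ≡ + 2 * (+ p + + g) + + ρ
  +-cast {p = p} {g} {ρ} refl = cong (_+ + ρ) (pos-* 2 (p ℕ.+ g))

  module SylvesterClosedForm {a d : ℕ} .{{_ : ℕ.NonZero a}} (coprime : Coprime a d) {p g ρ : ℕ}
    (a≡ : a ≡ 2 ℕ.* (p ℕ.+ g) ℕ.+ ρ) (ρ≤1 : ρ ≤ 1) where

    open Sylvester coprime {p} {g} a≡ ρ≤1 public

    U V : ℕ → ℤ
    U r = + a * (+ d + (+ p + + g) + (+ p - + 1) + + (r ⊔ ρ)) + + d * + r
    V r = (+ a + + d) * (+ 2 * + p + + r)

    private
      a%2≡ρ : a ℕ.% 2 ≡ ρ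
      a%2≡ρ = proj₁ (halves {a} {p ℕ.+ g} ρ≤1 a≡)
      a/2≡p+g : a ℕ./ 2 ≡ p ℕ.+ g
      a/2≡p+g = proj₂ (halves {a} {p ℕ.+ g} ρ≤1 a≡)

      +threshold : ∀ K j → + (a ℕ.* K ℕ.+ d ℕ.* j) ≡ + a * + K + + d * + j
      +threshold K j = cong₂ _+_ (pos-* a K) (pos-* d j)

    threshold-small : ∀ {h r} → r ≤ 1 → h < p → + T (2 ℕ.* h ℕ.+ r) ≡ U r + + 2 * + d * + h
    threshold-small {h} {r} r≤1 h<p@(s≤s {n = p′} _) = begin
      + T (2 ℕ.* h ℕ.+ r)                                                       ≡⟨ cong (λ K → + (a ℕ.* K ℕ.+ d ℕ.* (2 ℕ.* h ℕ.+ r))) K≡ ⟩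
      + (a ℕ.* (d ℕ.+ (p ℕ.+ g) ℕ.+ p′ ℕ.+ (r ⊔ ρ)) ℕ.+ d ℕ.* (2 ℕ.* h ℕ.+ r))    ≡⟨ +threshold _ _ ⟩
      + a * (+ d + (+ p + + g) + + p′ + + (r ⊔ ρ)) + + d * + (2 ℕ.* h ℕ.+ r)       ≡⟨ cong (λ j → + a * (+ d + (+ p + + g) + + p′ + + (r ⊔ ρ)) + + d * (j + + r)) (pos-* 2 h) ⟩
      + a * (+ d + (+ p + + g) + + p′ + + (r ⊔ ρ)) + + d * (+ 2 * + h + + r)       ≡⟨ regroup (+ a) (+ d) (+ p′) (+ g) (+ (r ⊔ ρ)) (+ h) (+ r) ⟩
      U r + + 2 * + d * + h                                                     ∎
      where
      open ≡-Reasoning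
      K≡ : thresholdDegree a d p (2 ℕ.* h ℕ.+ r) ≡ d ℕ.+ (p ℕ.+ g) ℕ.+ p′ ℕ.+ (r ⊔ ρ)
      K≡ = trans (thresholdDegree-small h<p r≤1) (cong₂ (λ m ρ′ → d ℕ.+ m ℕ.+ p′ ℕ.+ (r ⊔ ρ′)) a/2≡p+g a%2≡ρ)
      regroup : ∀ A d p′ g c h r → A * (d + (+ 1 + p′ + g) + p′ + c) + d * (+ 2 * h + r)
                                   ≡ A * (d + (+ 1 + p′ + g) + (+ 1 + p′ - + 1) + c) + d * r + + 2 * d * h
      regroup = solve-∀

    threshold-big : ∀ {e r} → r ≤ 1 → + T (2 ℕ.* p ℕ.+ (2 ℕ.* e ℕ.+ r)) ≡ V r + (+ a + + 2 * + d) * + e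
    threshold-big {e} {r} r≤1 = begin
      + T (2 ℕ.* p ℕ.+ (2 ℕ.* e ℕ.+ r))                                         ≡⟨ cong (λ K → + (a ℕ.* K ℕ.+ d ℕ.* j)) K≡ ⟩
      + (a ℕ.* (2 ℕ.* p ℕ.+ e ℕ.+ r) ℕ.+ d ℕ.* j)                                 ≡⟨ +threshold _ _ ⟩
      + a * (+ (2 ℕ.* p) + + e + + r) + + d * (+ (2 ℕ.* p) + (+ (2 ℕ.* e) + + r))  ≡⟨ cong₂ (λ x y → + a * (x + + e + + r) + + d * (x + (y + + r))) (pos-* 2 p) (pos-* 2 e) ⟩
      + a * (+ 2 * + p + + e + + r) + + d * (+ 2 * + p + (+ 2 * + e + + r))        ≡⟨ regroup (+ a) (+ d) (+ p) (+ e) (+ r) ⟩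
      V r + (+ a + + 2 * + d) * + e                                               ∎
      where
      open ≡-Reasoning
      j : ℕ
      j = 2 ℕ.* p ℕ.+ (2 ℕ.* e ℕ.+ r)
      K≡ : thresholdDegree a d p j ≡ 2 ℕ.* p ℕ.+ e ℕ.+ r
      K≡ = trans (cong (thresholdDegree a d p) (sym (ℕ.+-assoc (2 ℕ.* p) (2 ℕ.* e) r))) (thresholdDegree-big {a} {d} {p} {e} r≤1)
      regroup : ∀ A d p e r → A * (+ 2 * p + e + r) + d * (+ 2 * p + (+ 2 * e + r))
                              ≡ (A + d) * (+ 2 * p + r) + (A + + 2 * d) * e
      regroup = solve-∀

    ∑-by-classes : ∀ f → ∑ a f ≡ ∑ p (λ h → f (2 ℕ.* h)) ℕ.+ ∑ p (λ h → f (2 ℕ.* h ℕ.+ 1))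
                               ℕ.+ (∑ (g ℕ.+ ρ) (λ e → f (2 ℕ.* p ℕ.+ 2 ℕ.* e)) ℕ.+ ∑ g (λ e → f (2 ℕ.* p ℕ.+ (2 ℕ.* e ℕ.+ 1))))
    ∑-by-classes f = begin
      ∑ a f                                                        ≡⟨ cong (λ n → ∑ n f) (trans a≡ (cong (ℕ._+ ρ) (ℕ.*-distribˡ-+ 2 p g))) ⟩
      ∑ (2 ℕ.* p ℕ.+ 2 ℕ.* g ℕ.+ ρ) f                              ≡⟨ cong (λ n → ∑ n f) (ℕ.+-assoc (2 ℕ.* p) (2 ℕ.* g) ρ) ⟩
      ∑ (2 ℕ.* p ℕ.+ (2 ℕ.* g ℕ.+ ρ)) f                            ≡⟨ ∑-split (2 ℕ.* p) (2 ℕ.* g ℕ.+ ρ) f ⟩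
      ∑ (2 ℕ.* p) f ℕ.+ ∑ (2 ℕ.* g ℕ.+ ρ) (λ i → f (2 ℕ.* p ℕ.+ i)) ≡⟨ cong₂ ℕ._+_ (∑-evens-odds p f) (∑-by-parity g ρ (λ i → f (2 ℕ.* p ℕ.+ i)) ρ≤1) ⟩
      _                                                            ∎
      where open ≡-Reasoning

    ΣT ΣT² : ℤ
    ΣT  = apSum (+ p) (U 0) (+ 2 * + d) + apSum (+ p) (U 1) (+ 2 * + d)
          + (apSum (+ g + + ρ) (V 0) (+ a + + 2 * + d) + apSum (+ g) (V 1) (+ a + + 2 * + d))
    ΣT² = apSquareSum (+ p) (U 0) (+ 2 * + d) + apSquareSum (+ p) (U 1) (+ 2 * + d)
          + (apSquareSum (+ g + + ρ) (V 0) (+ a + + 2 * + d) + apSquareSum (+ g) (V 1) (+ a + + 2 * + d))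

    private
      small-evens : ∀ h → h < p → + T (2 ℕ.* h) ≡ U 0 + + 2 * + d * + h
      small-evens h h<p = trans (cong (+_ ∘ T) (sym (ℕ.+-identityʳ (2 ℕ.* h)))) (threshold-small z≤n h<p)
      small-odds : ∀ h → h < p → + T (2 ℕ.* h ℕ.+ 1) ≡ U 1 + + 2 * + d * + h
      small-odds h h<p = threshold-small ℕ.≤-refl h<p
      big-evens : ∀ e → e < g ℕ.+ ρ → + T (2 ℕ.* p ℕ.+ 2 ℕ.* e) ≡ V 0 + (+ a + + 2 * + d) * + e
      big-evens e _ = trans (cong (λ i → + T (2 ℕ.* p ℕ.+ i)) (sym (ℕ.+-identityʳ (2 ℕ.* e)))) (threshold-big z≤n)
      big-odds : ∀ e → e < g → + T (2 ℕ.* p ℕ.+ (2 ℕ.* e ℕ.+ 1)) ≡ V 1 + (+ a + + 2 * + d) * + e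
      big-odds e _ = threshold-big ℕ.≤-refl
      distrib : ∀ k w x y z → k * (w + x + (y + z)) ≡ k * w + k * x + (k * y + k * z)
      distrib = solve-∀

    private
      Tₑ Tₒ Bₑ Bₒ : ℕ → ℕ
      Tₑ h = T (2 ℕ.* h)
      Tₒ h = T (2 ℕ.* h ℕ.+ 1)
      Bₑ e = T (2 ℕ.* p ℕ.+ 2 ℕ.* e)
      Bₒ e = T (2 ℕ.* p ℕ.+ (2 ℕ.* e ℕ.+ 1))

    twice-∑T : + 2 * + ∑ a T ≡ ΣT
    twice-∑T = trans (cong (λ n → + 2 * + n) (∑-by-classes T))
      (trans (distrib (+ 2) (+ ∑ p Tₑ) (+ ∑ p Tₒ) (+ ∑ (g ℕ.+ ρ) Bₑ) (+ ∑ g Bₒ))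
        (cong₂ _+_ (cong₂ _+_ (∑-ap Tₑ (U 0) (+ 2 * + d) p small-evens) (∑-ap Tₒ (U 1) (+ 2 * + d) p small-odds))
                   (cong₂ _+_ (∑-ap Bₑ (V 0) (+ a + + 2 * + d) (g ℕ.+ ρ) big-evens) (∑-ap Bₒ (V 1) (+ a + + 2 * + d) g big-odds))))

    six-∑T² : + 6 * + ∑ a (λ j → T j ℕ.* T j) ≡ ΣT²
    six-∑T² = trans (cong (λ n → + 6 * + n) (∑-by-classes (λ j → T j ℕ.* T j)))
      (trans (distrib (+ 6) (+ ∑ p (λ h → Tₑ h ℕ.* Tₑ h)) (+ ∑ p (λ h → Tₒ h ℕ.* Tₒ h))
                            (+ ∑ (g ℕ.+ ρ) (λ e → Bₑ e ℕ.* Bₑ e)) (+ ∑ g (λ e → Bₒ e ℕ.* Bₒ e)))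
        (cong₂ _+_ (cong₂ _+_ (∑-ap² Tₑ (U 0) (+ 2 * + d) p small-evens) (∑-ap² Tₒ (U 1) (+ 2 * + d) p small-odds))
                   (cong₂ _+_ (∑-ap² Bₑ (V 0) (+ a + + 2 * + d) (g ℕ.+ ρ) big-evens) (∑-ap² Bₒ (V 1) (+ a + + 2 * + d) g big-odds))))

    twice-∑residues : + 2 * + ∑ a id ≡ apSum (+ a) (+ 0) (+ 1)
    twice-∑residues = ∑-ap id (+ 0) (+ 1) a (λ c _ → as-progression (+ c))
      where
      as-progression : ∀ c → c ≡ + 0 + + 1 * c
      as-progression = solve-∀

    six-∑residues² : + 6 * + ∑ a (λ c → c ℕ.* c) ≡ apSquareSum (+ a) (+ 0) (+ 1)
    six-∑residues² = ∑-ap² id (+ 0) (+ 1) a (λ c _ → as-progression (+ c))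
      where
      as-progression : ∀ c → c ≡ + 0 + + 1 * c
      as-progression = solve-∀

    s : ℕ
    s = sylvesterSumBelow a d p (a ℕ.* Q)

    selmer-ℤ : + 2 * + a * + s + + ∑ a (λ c → c ℕ.* c) + + a * + ∑ a T ≡ + ∑ a (λ j → T j ℕ.* T j) + + a * + ∑ a id
    selmer-ℤ = begin
        + 2 * + a * + s + + ∑ a (λ c → c ℕ.* c) + + a * + ∑ a T
          ≡⟨ cong₂ (λ u v → u + + ∑ a (λ c → c ℕ.* c) + v) (trans (pos-* (2 ℕ.* a) s) (cong (_* + s) (pos-* 2 a))) (pos-* a (∑ a T)) ⟨
        + (2 ℕ.* a ℕ.* s ℕ.+ ∑ a (λ c → c ℕ.* c) ℕ.+ a ℕ.* ∑ a T)
          ≡⟨ cong +_ selmer-identity ⟩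
        + (∑ a (λ j → T j ℕ.* T j) ℕ.+ a ℕ.* ∑ a id)
          ≡⟨ cong (λ v → + ∑ a (λ j → T j ℕ.* T j) + v) (pos-* a (∑ a id)) ⟩
        + ∑ a (λ j → T j ℕ.* T j) + + a * + ∑ a id  ∎
      where open ≡-Reasoning

    24s≡ : ∀ t → + 2 * ΣT² + + 6 * + a * apSum (+ a) (+ 0) (+ 1) - + 2 * apSquareSum (+ a) (+ 0) (+ 1) - + 6 * + a * ΣT ≡ + a * t →
           + 24 * + s ≡ t
    24s≡ t closed-form≡at = *-cancelˡ-≡ (+ a) (+ 24 * + s) t (begin
      + a * (+ 24 * + s)                                                     ≡⟨ isolate (+ a) (+ s) C² Tsum ⟩
      + 12 * (+ 2 * + a * + s + C² + + a * Tsum) - + 12 * C² - + 12 * + a * Tsum ≡⟨ cong (λ x → + 12 * x - + 12 * C² - + 12 * + a * Tsum) selmer-ℤ ⟩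
      + 12 * (T²sum + + a * C) - + 12 * C² - + 12 * + a * Tsum                  ≡⟨ regroup (+ a) C C² Tsum T²sum ⟩
      + 2 * (+ 6 * T²sum) + + 6 * + a * (+ 2 * C) - + 2 * (+ 6 * C²) - + 6 * + a * (+ 2 * Tsum)
        ≡⟨ cong₂ (λ u v → + 2 * u + + 6 * + a * v - + 2 * (+ 6 * C²) - + 6 * + a * (+ 2 * Tsum)) six-∑T² twice-∑residues ⟩
      + 2 * ΣT² + + 6 * + a * apSum (+ a) (+ 0) (+ 1) - + 2 * (+ 6 * C²) - + 6 * + a * (+ 2 * Tsum)
        ≡⟨ cong₂ (λ u v → + 2 * ΣT² + + 6 * + a * apSum (+ a) (+ 0) (+ 1) - + 2 * u - + 6 * + a * v) six-∑residues² twice-∑T ⟩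
      + 2 * ΣT² + + 6 * + a * apSum (+ a) (+ 0) (+ 1) - + 2 * apSquareSum (+ a) (+ 0) (+ 1) - + 6 * + a * ΣT
        ≡⟨ closed-form≡at ⟩
      + a * t                                                                ∎)
      where
      open ≡-Reasoning
      C C² Tsum T²sum : ℤ
      C = + ∑ a id
      C² = + ∑ a (λ c → c ℕ.* c)
      Tsum = + ∑ a T
      T²sum = + ∑ a (λ j → T j ℕ.* T j)
      isolate : ∀ A s C² Tsum → A * (+ 24 * s) ≡ + 12 * (+ 2 * A * s + C² + A * Tsum) - + 12 * C² - + 12 * A * Tsum
      isolate = solve-∀
      regroup : ∀ A C C² Tsum T²sum → + 12 * (T²sum + A * C) - + 12 * C² - + 12 * A * Tsum
                                      ≡ + 2 * (+ 6 * T²sum) + + 6 * A * (+ 2 * C) - + 2 * (+ 6 * C²) - + 6 * A * (+ 2 * Tsum)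
      regroup = solve-∀

open import Defs
open Representations using (parity-decomposition)
open ClosedForm
import Data.Nat as ℕ
open import Data.Nat using (ℕ; _≤_; _<_; _/_; _%_; s≤s; z≤n)
import Data.Nat.Properties as ℕ
open import Data.Nat.Properties using (m≤n⇒∃[o]m+o≡n)
open import Data.Nat.DivMod using (m%n<n)
open import Data.Nat.GCD using (gcd)
open import Data.Nat.Coprimality using (gcd≡1⇒coprime)
open import Data.Integer using (+_; _+_; _-_; _*_)
open import Data.Integer.Tactic.RingSolver using (solve)
open import Data.List using ([]; _∷_)
open import Relation.Binary.PropositionalEquality
open import Data.Product using (Σ; _×_; _,_; proj₂)

-- The ring solver does not unfold definitions, so apSum, apSquareSum, U and V reappear as local
-- abbreviations in these two polynomial identities.
odd-identity : ∀ a p g d → a ≡ + 2 * (p + g) + + 1 →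
  let ap  = λ n u v → + 2 * n * u + v * (n * n - n)
      ap² = λ n u v → + 6 * n * u * u + + 6 * u * v * (n * n - n) + v * v * (+ 2 * n * n * n - + 3 * n * n + n)
      u   = λ r c → a * (d + (p + g) + (p - + 1) + c) + d * r
      v   = λ r → (a + d) * (+ 2 * p + r)
      ΣT  = ap p (u (+ 0) (+ 1)) (+ 2 * d) + ap p (u (+ 1) (+ 1)) (+ 2 * d)
            + (ap (g + + 1) (v (+ 0)) (a + + 2 * d) + ap g (v (+ 1)) (a + + 2 * d))
      ΣT² = ap² p (u (+ 0) (+ 1)) (+ 2 * d) + ap² p (u (+ 1) (+ 1)) (+ 2 * d)
            + (ap² (g + + 1) (v (+ 0)) (a + + 2 * d) + ap² g (v (+ 1)) (a + + 2 * d))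
  in  + 2 * ΣT² + + 6 * a * ap a (+ 0) (+ 1) - + 2 * ap² a (+ 0) (+ 1) - + 6 * a * ΣT
      ≡ a * ((a - + 1) * (a + + 2 * d - + 1) * (a * a + + 2 * a * d - a - d - + 2)
             + + 4 * (+ 3 * a * a * a + + 9 * a * a * (d - + 1) + + 2 * a * (+ 3 * d * d - + 9 * d + + 1) - + 6 * d * d + + 2 * d) * p
             + + 12 * (+ 3 * a * a + a * (+ 6 * d - + 1) + + 4 * d * d - d) * p * p
             - + 32 * (a + d) * p * p * p)
odd-identity _ p g d refl = solve (p ∷ g ∷ d ∷ [])

even-identity : ∀ a p g d → a ≡ + 2 * (p + g) + + 0 →
  let ap  = λ n u v → + 2 * n * u + v * (n * n - n)
      ap² = λ n u v → + 6 * n * u * u + + 6 * u * v * (n * n - n) + v * v * (+ 2 * n * n * n - + 3 * n * n + n)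
      u   = λ r c → a * (d + (p + g) + (p - + 1) + c) + d * r
      v   = λ r → (a + d) * (+ 2 * p + r)
      ΣT  = ap p (u (+ 0) (+ 0)) (+ 2 * d) + ap p (u (+ 1) (+ 1)) (+ 2 * d)
            + (ap (g + + 0) (v (+ 0)) (a + + 2 * d) + ap g (v (+ 1)) (a + + 2 * d))
      ΣT² = ap² p (u (+ 0) (+ 0)) (+ 2 * d) + ap² p (u (+ 1) (+ 1)) (+ 2 * d)
            + (ap² (g + + 0) (v (+ 0)) (a + + 2 * d) + ap² g (v (+ 1)) (a + + 2 * d))
  in  + 2 * ΣT² + + 6 * a * ap a (+ 0) (+ 1) - + 2 * ap² a (+ 0) (+ 1) - + 6 * a * ΣT
      ≡ a * ((a - + 1) * (a + + 2 * d - + 1) * (a * a + + 2 * a * d - a - d - + 2)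
             + + 3 * (a * a + + 2 * a * d - a - d)
             + + 4 * (+ 3 * a * a * a + + 9 * a * a * (d - + 1) + a * (+ 6 * d * d - + 18 * d + + 5) - + 6 * d * d + + 5 * d) * p
             + + 12 * (+ 3 * a * a + a * (+ 6 * d - + 1) + + 4 * d * d - d) * p * p
             - + 32 * (a + d) * p * p * p)
even-identity _ p g d refl = solve (p ∷ g ∷ d ∷ [])

a≡2[p+g]+ρ : ∀ {a p g ρ} → p ℕ.+ g ≡ a / 2 → a % 2 ≡ ρ → a ≡ 2 ℕ.* (p ℕ.+ g) ℕ.+ ρ
a≡2[p+g]+ρ {a} {p} {g} {ρ} p+g≡a/2 a%2≡ρ = trans (proj₂ (parity-decomposition a))
  (trans (cong₂ (λ r h → r ℕ.+ 2 ℕ.* h) a%2≡ρ (sym p+g≡a/2)) (ℕ.+-comm ρ _))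

theorem2 : (a d p : ℕ) → 3 ≤ a → 0 < d → gcd a d ≡ 1 → p ≤ a / 2 →
    Σ ℕ (λ B →
      ((n : ℕ) → B ≤ n → p < repCount a d n) ×
      ((a % 2 ≡ 1 →
        + 24 * + sylvesterSumBelow a d p B ≡
          (+ a - + 1) * (+ a + + 2 * + d - + 1) * (+ a * + a + + 2 * + a * + d - + a - + d - + 2)
          + + 4 * (+ 3 * + a * + a * + a + + 9 * + a * + a * (+ d - + 1) + + 2 * + a * (+ 3 * + d * + d - + 9 * + d + + 1) - + 6 * + d * + d + + 2 * + d) * + p
          + + 12 * (+ 3 * + a * + a + + a * (+ 6 * + d - + 1) + + 4 * + d * + d - + d) * + p * + p
          - + 32 * (+ a + + d) * + p * + p * + p)
      × (a % 2 ≡ 0 →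
        + 24 * + sylvesterSumBelow a d p B ≡
          (+ a - + 1) * (+ a + + 2 * + d - + 1) * (+ a * + a + + 2 * + a * + d - + a - + d - + 2)
          + + 3 * (+ a * + a + + 2 * + a * + d - + a - + d)
          + + 4 * (+ 3 * + a * + a * + a + + 9 * + a * + a * (+ d - + 1) + + a * (+ 6 * + d * + d - + 18 * + d + + 5) - + 6 * + d * + d + + 5 * + d) * + p
          + + 12 * (+ 3 * + a * + a + + a * (+ 6 * + d - + 1) + + 4 * + d * + d - + d) * + p * + p
          - + 32 * (+ a + + d) * + p * + p * + p)))
theorem2 a d p 3≤a _ gcd≡1 p≤a/2 with m≤n⇒∃[o]m+o≡n p≤a/2 | a % 2 in a%2≡ρ | ℕ.≤-pred (m%n<n a 2)
... | g , p+g≡a/2 | 0 | _ =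
  a ℕ.* Q , beyond-aQ , (λ ()) , λ _ → 24s≡ _ (even-identity (+ a) (+ p) (+ g) (+ d) (+-cast {a} {p} {g} {0} a≡))
  where
  a≡ : a ≡ 2 ℕ.* (p ℕ.+ g) ℕ.+ 0
  a≡ = a≡2[p+g]+ρ {a} {p} {g} p+g≡a/2 a%2≡ρ
  open SylvesterClosedForm {{ℕ.>-nonZero (ℕ.<-≤-trans (s≤s z≤n) 3≤a)}} (gcd≡1⇒coprime gcd≡1) {p} {g} a≡ z≤n
... | g , p+g≡a/2 | 1 | _ =
  a ℕ.* Q , beyond-aQ , (λ _ → 24s≡ _ (odd-identity (+ a) (+ p) (+ g) (+ d) (+-cast {a} {p} {g} {1} a≡))) , λ ()
  where
  a≡ : a ≡ 2 ℕ.* (p ℕ.+ g) ℕ.+ 1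
  a≡ = a≡2[p+g]+ρ {a} {p} {g} p+g≡a/2 a%2≡ρ
  open SylvesterClosedForm {{ℕ.>-nonZero (ℕ.<-≤-trans (s≤s z≤n) 3≤a)}} (gcd≡1⇒coprime gcd≡1) {p} {g} a≡ (s≤s z≤n)
... | _ | ℕ.suc (ℕ.suc _) | s≤s ()
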